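{- Let $k \geq 5$ be an integer and let $p \equiv 1 \pmod 4$ be a prime. Let $\lambda_1,\dots,\lambda_{2k}$ be distinct elements of $\mathbb{F}_p$ and write $\lambda_{ij} = \lambda_j - \lambda_i$. Suppose that (1) $\lambda_1 = 0$ and $\lambda_2 = 1$; (2) for $i \in \{3,4\}$ and $j \in \{1,2\}$, $\chi(\lambda_{1i}\lambda_{i2}) = \chi(\lambda_{3j}\lambda_{j4}) = -1$; (3) for all $5 \leq i \leq k+2 < j \leq 2k$, $\chi(\lambda_{1i}\lambda_{i2}) = \chi(\lambda_{3j}\lambda_{j4}) = 1$. Let $G_p$ be the graph with vertex set $\bigcup_{i=1}^{2k} X_i$, where $X_i = \mathbb{F}_p^2 \times \{i\}$, in which for each edge $\{i,j\}$ of $H_k$ with $i<j$, a vertex $(x,i)$ is adjacent to $(y,j)$ if and only if there exists $a \in \mathbb{F}_p^*$ with $y = x + (\lambda_j - \lambda_i)(a,a^2)$ (and there are no other edges). Then every edge of $G_p$ is contained in exactly one subgraph of $G_p$ isomorphic to $H_k$.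
   Context: $\chi$ denotes the quadratic character of $\mathbb{F}_p$: $\chi(x)=1$ if $x$ is a nonzero square, $\chi(x)=-1$ if $x$ is a nonsquare, $\chi(0)=0$. $H_k$ is the graph with vertex set $\{1,\dots,2k\}$ and edge set $\{\{1,i\},\{2,i\},\{3,j\},\{4,j\} : 3 \leq i \leq k+2 < j \leq 2k\}$. Scalar multiplication $\lambda (a,a^2)$ is componentwise in $\mathbb{F}_p^2$. -}

module Defs where

open import Data.Nat using (ℕ; zero; suc; _+_; _*_; _∸_; _≤_; _<_; NonZero)
open import Data.Nat.DivMod using (_mod_)
open import Data.Nat.Primality using (Prime; prime⇒nonZero)
open import Data.Fin using (Fin; toℕ) renaming (_≟_ to _≟F_)
open import Data.Fin.Properties using (any?)
open import Data.Integer using (ℤ; 0ℤ; 1ℤ; -1ℤ)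
open import Data.Product using (Σ; ∃; _×_; _,_)
open import Data.Sum using (_⊎_)
open import Relation.Nullary using (¬_; yes; no)
open import Relation.Binary.PropositionalEquality using (_≡_; _≢_)

module Fp (p : ℕ) (pr : Prime p) where
  private instance
    nz : NonZero p
    nz = prime⇒nonZero pr

  F : Set
  F = Fin p

  0F : F
  0F = 0 mod p

  1F : F
  1F = 1 mod p

  infixl 6 _+F_ _-F_
  infixl 7 _*F_

  _+F_ : F → F → F
  x +F y = (toℕ x + toℕ y) mod p

  _*F_ : F → F → F
  x *F y = (toℕ x * toℕ y) mod p

  _-F_ : F → F → F
  x -F y = (toℕ x + (p ∸ toℕ y)) mod p

  χ : F → ℤ
  χ x with x ≟F 0F
  ... | yes _ = 0ℤ
  ... | no _ with any? (λ (y : F) → (y *F y) ≟F x)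
  ...   | yes _ = 1ℤ
  ...   | no _ = -1ℤ

-- Label of a vertex index: the index i : Fin n stands for the number i+1 ∈ {1,…,n}.
lab : ∀ {n} → Fin n → ℕ
lab i = suc (toℕ i)

HArc : ℕ → ℕ → ℕ → Set
HArc k i j = ((i ≡ 1 ⊎ i ≡ 2) × 3 ≤ j × j ≤ k + 2)
           ⊎ ((i ≡ 3 ⊎ i ≡ 4) × k + 2 < j × j ≤ 2 * k)

HEdge : (k : ℕ) → Fin (2 * k) → Fin (2 * k) → Set
HEdge k a b = HArc k (lab a) (lab b) ⊎ HArc k (lab b) (lab a)

module Gp (p k : ℕ) (pr : Prime p) (lam : ℕ → Fin p) where
  open Fp p pr

  V : Set
  V = (F × F) × Fin (2 * k)

  _·_ : F → F × F → F × F
  c · (a , b) = (c *F a , c *F b)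

  _⊕_ : F × F → F × F → F × F
  (a , b) ⊕ (c , d) = (a +F c , b +F d)

  GArc : V → V → Set
  GArc (x , i) (y , j) =
    HArc k (lab i) (lab j) ×
    ∃ λ (a : F) → a ≢ 0F × y ≡ x ⊕ ((lam (lab j) -F lam (lab i)) · (a , a *F a))

  GAdj : V → V → Set
  GAdj u v = GArc u v ⊎ GArc v u

  IsCopy : (Fin (2 * k) → V) → Set
  IsCopy φ = (∀ a b → φ a ≡ φ b → a ≡ b) × (∀ a b → HEdge k a b → GAdj (φ a) (φ b))

  EdgeOf : (Fin (2 * k) → V) → V → V → Set
  EdgeOf φ u v = ∃ λ a → ∃ λ b → HEdge k a b × φ a ≡ u × φ b ≡ v

module Submission where

-- A line {(o₁ + λ_i c , o₂ + λ_i c²) in part i} with c ≠ 0 is a copy of H_k, and every edge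
-- of G_p lies on exactly one line. Conversely, let x, x' lie in parts labelled κ ≠ μ and let y, in a part
-- labelled ν, be a common neighbour reached with parameters a and b. Then Y = (ν−κ)(ν−μ)(a−b) determines
-- y, while Y² = (ν−κ)(μ−ν)·Δ with Δ = (μ−κ)(x'₂−x₂) − (x'₁−x₁)² does not depend on y; so two vertices have
-- at most two common neighbours in any part (at most one if they share a part). The hub vertices 1, 2 of
-- H_k (likewise 3, 4) have five common neighbours, so in a copy their images lie in the parts of one hub
-- pair, {1, 2} or {3, 4}, and in fact in both of them. For these images (ν−κ)(μ−ν) is a nonsquare on the
-- other hub pair by (2) and a nonzero square on the leaves by (3), so Δ ≠ 0 would confine all their
-- common neighbours to two parts. Hence Δ = 0, which puts both images on a line, and then Y = 0 puts every
-- further vertex of the copy on that line. The part map of the copy is an automorphism of H_k, so the copy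
-- has exactly the edges of the line.

open import Defs
open import Level using (0ℓ)
open import Algebra.Bundles using (CommutativeRing)
open import Algebra.Core using (Op₁; Op₂)
open import Algebra.Structures using (IsCommutativeRing)
open import Data.Empty using (⊥-elim)
open import Data.Fin using (Fin; toℕ; fromℕ<; punchOut; #_; zero; suc) renaming (_≟_ to _≟F_)
open import Data.Fin.Properties using (toℕ-injective; toℕ-fromℕ<; toℕ<n; any?; punchOut-injective; injective⇒≤)
open import Data.Integer using (0ℤ; 1ℤ; -1ℤ)
open import Data.Nat using (ℕ; zero; suc; _≤_; _<_; _∸_; _%_; z≤n; s≤s; _<?_; NonZero)
import Data.Nat as ℕ
import Data.Nat.Properties as ℕ
open import Data.Nat.Primality using (Prime; ¬prime[1])
open import Data.Product using (Σ; ∃; ∃₂; _×_; _,_; proj₁; proj₂)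
open import Data.Product.Properties using (,-injective)
open import Data.Sum using (_⊎_; inj₁; inj₂; [_,_])
open import Function.Base using (_∘_)
open import Function.Bundles using (_⇔_; mk⇔; Equivalence)
open import Function.Properties.Equivalence using (⇔-isEquivalence)
open import Relation.Binary.Definitions using (DecidableEquality)
open import Relation.Binary.PropositionalEquality hiding ([_])
open import Relation.Binary.Structures using (IsEquivalence)
open import Relation.Nullary using (¬_; Dec; yes; no)

-- The ring homomorphism ℤ → R, which lets Algebra.Solver.Ring normalise with integer coefficients.
module IntegerEmbedding
  {R : Set} {add mul : Op₂ R} {neg : Op₁ R} {zero# one# : R}
  (isCommutativeRing : IsCommutativeRing _≡_ add mul neg zero# one#) where

  import Algebra.Solver.Ring
  open import Algebra.Solver.Ring.AlmostCommutativeRing using (fromCommutativeRing; _-Raw-AlmostCommutative⟶_)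
  open import Data.Integer as ℤ using (ℤ; +_; -[1+_]; _⊖_; _◃_; ∣_∣; sign)
  import Data.Integer.Properties as ℤ
  open import Data.Maybe using (Maybe; just; nothing)
  open import Data.Sign as Sign using (Sign)

  commutativeRing : CommutativeRing 0ℓ 0ℓ
  commutativeRing = record { isCommutativeRing = isCommutativeRing }

  open CommutativeRing commutativeRing
    using (_+_; _*_; -_; _-_; 0#; 1#; +-assoc; +-comm; +-identityʳ; -‿inverseʳ; semiring; ring; +-group; +-abelianGroup)
  open import Algebra.Properties.Semiring.Mult semiring using (×-homo-+; ×1-homo-*) renaming (_×_ to _×ᵣ_)
  open import Algebra.Properties.Group +-group using (ε⁻¹≈ε; ⁻¹-involutive; ⁻¹-anti-homo-//)
  open import Algebra.Properties.AbelianGroup +-abelianGroup using (⁻¹-∙-comm)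
  open import Algebra.Properties.Ring ring using (-‿distribˡ-*; -‿distribʳ-*)
  open ≡-Reasoning

  signed : Sign → R → R
  signed Sign.+ x = x
  signed Sign.- x = - x

  fromℤ : ℤ → R
  fromℤ i = signed (sign i) (∣ i ∣ ×ᵣ 1#)

  fromℤ-◃ : ∀ s n → fromℤ (s ◃ n) ≡ signed s (n ×ᵣ 1#)
  fromℤ-◃ Sign.- zero    = sym ε⁻¹≈ε
  fromℤ-◃ Sign.+ zero    = refl
  fromℤ-◃ Sign.- (suc n) = refl
  fromℤ-◃ Sign.+ (suc n) = refl

  fromℤ-neg : ∀ i → fromℤ (ℤ.- i) ≡ - fromℤ i
  fromℤ-neg -[1+ n ]    = sym (⁻¹-involutive _)
  fromℤ-neg (+ zero)    = sym ε⁻¹≈ε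
  fromℤ-neg (+ (suc n)) = refl

  signed-* : ∀ s t x y → signed (s Sign.* t) (x * y) ≡ signed s x * signed t y
  signed-* Sign.+ Sign.+ x y = refl
  signed-* Sign.+ Sign.- x y = -‿distribʳ-* x y
  signed-* Sign.- Sign.+ x y = -‿distribˡ-* x y
  signed-* Sign.- Sign.- x y = begin
    x * y         ≡⟨ sym (⁻¹-involutive _) ⟩
    - - (x * y)   ≡⟨ cong -_ (-‿distribʳ-* x y) ⟩
    - (x * - y)   ≡⟨ -‿distribˡ-* x (- y) ⟩
    - x * - y     ∎

  fromℤ-* : ∀ i j → fromℤ (i ℤ.* j) ≡ fromℤ i * fromℤ j
  fromℤ-* i j = begin
    fromℤ (i ℤ.* j)                                      ≡⟨ fromℤ-◃ (sign i Sign.* sign j) (∣ i ∣ ℕ.* ∣ j ∣) ⟩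
    signed (sign i Sign.* sign j) ((∣ i ∣ ℕ.* ∣ j ∣) ×ᵣ 1#) ≡⟨ cong (signed (sign i Sign.* sign j)) (×1-homo-* ∣ i ∣ ∣ j ∣) ⟩
    signed (sign i Sign.* sign j) ((∣ i ∣ ×ᵣ 1#) * (∣ j ∣ ×ᵣ 1#)) ≡⟨ signed-* (sign i) (sign j) _ _ ⟩
    fromℤ i * fromℤ j                                    ∎

  ×-monus : ∀ {m n} → n ℕ.≤ m → (m ℕ.∸ n) ×ᵣ 1# ≡ m ×ᵣ 1# - n ×ᵣ 1#
  ×-monus {m} {n} n≤m = begin
    (m ℕ.∸ n) ×ᵣ 1#                          ≡⟨ sym (+-identityʳ _) ⟩
    (m ℕ.∸ n) ×ᵣ 1# + 0#                     ≡⟨ cong (λ z → (m ℕ.∸ n) ×ᵣ 1# + z) (sym (-‿inverseʳ (n ×ᵣ 1#))) ⟩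
    (m ℕ.∸ n) ×ᵣ 1# + (n ×ᵣ 1# - n ×ᵣ 1#)      ≡⟨ sym (+-assoc _ _ _) ⟩
    ((m ℕ.∸ n) ×ᵣ 1# + n ×ᵣ 1#) - n ×ᵣ 1#      ≡⟨ cong (_- n ×ᵣ 1#) (sym (×-homo-+ 1# (m ℕ.∸ n) n)) ⟩
    ((m ℕ.∸ n) ℕ.+ n) ×ᵣ 1# - n ×ᵣ 1#         ≡⟨ cong (λ k → k ×ᵣ 1# - n ×ᵣ 1#) (ℕ.m∸n+n≡m n≤m) ⟩
    m ×ᵣ 1# - n ×ᵣ 1#                         ∎

  fromℤ-⊖ : ∀ m n → fromℤ (m ⊖ n) ≡ m ×ᵣ 1# - n ×ᵣ 1#
  fromℤ-⊖ m n with m ℕ.<? n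
  ... | yes m<n = begin
    fromℤ (m ⊖ n)                 ≡⟨ cong fromℤ (ℤ.⊖-< m<n) ⟩
    fromℤ (ℤ.- + (n ℕ.∸ m))       ≡⟨ fromℤ-neg (+ (n ℕ.∸ m)) ⟩
    - ((n ℕ.∸ m) ×ᵣ 1#)            ≡⟨ cong -_ (×-monus (ℕ.<⇒≤ m<n)) ⟩
    - (n ×ᵣ 1# - m ×ᵣ 1#)           ≡⟨ ⁻¹-anti-homo-// _ _ ⟩
    m ×ᵣ 1# - n ×ᵣ 1#               ∎
  ... | no m≮n = trans (cong fromℤ (ℤ.⊖-≥ (ℕ.≮⇒≥ m≮n))) (×-monus (ℕ.≮⇒≥ m≮n))

  fromℤ-+ : ∀ i j → fromℤ (i ℤ.+ j) ≡ fromℤ i + fromℤ j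
  fromℤ-+ -[1+ m ] -[1+ n ] = begin
    - (suc (suc (m ℕ.+ n)) ×ᵣ 1#)        ≡⟨ cong (λ k → - (k ×ᵣ 1#)) (sym (ℕ.+-suc (suc m) n)) ⟩
    - ((suc m ℕ.+ suc n) ×ᵣ 1#)          ≡⟨ cong -_ (×-homo-+ 1# (suc m) (suc n)) ⟩
    - (suc m ×ᵣ 1# + suc n ×ᵣ 1#)         ≡⟨ sym (⁻¹-∙-comm _ _) ⟩
    - (suc m ×ᵣ 1#) + - (suc n ×ᵣ 1#)     ∎
  fromℤ-+ -[1+ m ] (+ n) = trans (fromℤ-⊖ n (suc m)) (+-comm _ _)
  fromℤ-+ (+ m)    -[1+ n ] = fromℤ-⊖ m (suc n)
  fromℤ-+ (+ m)    (+ n)    = ×-homo-+ 1# m n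

  homomorphism : ℤ.+-*-rawRing -Raw-AlmostCommutative⟶ fromCommutativeRing commutativeRing
  homomorphism = record
    { ⟦_⟧    = fromℤ
    ; +-homo = fromℤ-+
    ; *-homo = fromℤ-*
    ; -‿homo = fromℤ-neg
    ; 0-homo = refl
    ; 1-homo = +-identityʳ 1#
    }

  fromℤ-≟ : ∀ i j → Maybe (fromℤ i ≡ fromℤ j)
  fromℤ-≟ i j with i ℤ.≟ j
  ... | yes refl = just refl
  ... | no _     = nothing

  open Algebra.Solver.Ring ℤ.+-*-rawRing (fromCommutativeRing commutativeRing) homomorphism fromℤ-≟ public
    using (solve; _:=_; _:+_; _:*_; _:-_; :-_; con)

record Coincidence {A : Set} (f : Fin 5 → A) : Set where
  constructor coincide
  field
    t₀ t₁ t₂   : Fin 5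
    t₀≢t₁      : t₀ ≢ t₁
    t₀≢t₂      : t₀ ≢ t₂
    t₁≢t₂      : t₁ ≢ t₂
    f₀≡f₁      : f t₀ ≡ f t₁
    f₀≡f₂      : f t₀ ≡ f t₂

coincidence : ∀ {A : Set} {f : Fin 5 → A} {x} t₀ t₁ t₂ → t₀ ≢ t₁ → t₀ ≢ t₂ → t₁ ≢ t₂ →
        f t₀ ≡ x → f t₁ ≡ x → f t₂ ≡ x → Coincidence f
coincidence t₀ t₁ t₂ t₀≢t₁ t₀≢t₂ t₁≢t₂ e₀ e₁ e₂ =
  coincide t₀ t₁ t₂ t₀≢t₁ t₀≢t₂ t₁≢t₂ (trans e₀ (sym e₁)) (trans e₀ (sym e₂))

three-of-five : ∀ {A : Set} {c d : A} (f : Fin 5 → A) → (∀ t → f t ≡ c ⊎ f t ≡ d) → Coincidence f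
three-of-five f two-values with two-values (# 0) | two-values (# 1) | two-values (# 2) | two-values (# 3) | two-values (# 4)
... | inj₁ e₀ | inj₁ e₁ | inj₁ e₂ | _       | _       = coincidence (# 0) (# 1) (# 2) (λ ()) (λ ()) (λ ()) e₀ e₁ e₂
... | inj₂ e₀ | inj₂ e₁ | inj₂ e₂ | _       | _       = coincidence (# 0) (# 1) (# 2) (λ ()) (λ ()) (λ ()) e₀ e₁ e₂
... | inj₁ e₀ | inj₁ e₁ | inj₂ _  | inj₁ e₃ | _       = coincidence (# 0) (# 1) (# 3) (λ ()) (λ ()) (λ ()) e₀ e₁ e₃
... | inj₁ e₀ | inj₁ e₁ | inj₂ _  | inj₂ _  | inj₁ e₄ = coincidence (# 0) (# 1) (# 4) (λ ()) (λ ()) (λ ()) e₀ e₁ e₄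
... | inj₁ _  | inj₁ _  | inj₂ e₂ | inj₂ e₃ | inj₂ e₄ = coincidence (# 2) (# 3) (# 4) (λ ()) (λ ()) (λ ()) e₂ e₃ e₄
... | inj₂ e₀ | inj₂ e₁ | inj₁ _  | inj₂ e₃ | _       = coincidence (# 0) (# 1) (# 3) (λ ()) (λ ()) (λ ()) e₀ e₁ e₃
... | inj₂ e₀ | inj₂ e₁ | inj₁ _  | inj₁ _  | inj₂ e₄ = coincidence (# 0) (# 1) (# 4) (λ ()) (λ ()) (λ ()) e₀ e₁ e₄
... | inj₂ _  | inj₂ _  | inj₁ e₂ | inj₁ e₃ | inj₁ e₄ = coincidence (# 2) (# 3) (# 4) (λ ()) (λ ()) (λ ()) e₂ e₃ e₄
... | inj₁ e₀ | inj₂ _  | inj₁ e₂ | inj₁ e₃ | _       = coincidence (# 0) (# 2) (# 3) (λ ()) (λ ()) (λ ()) e₀ e₂ e₃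
... | inj₁ e₀ | inj₂ _  | inj₁ e₂ | inj₂ _  | inj₁ e₄ = coincidence (# 0) (# 2) (# 4) (λ ()) (λ ()) (λ ()) e₀ e₂ e₄
... | inj₁ _  | inj₂ e₁ | inj₁ _  | inj₂ e₃ | inj₂ e₄ = coincidence (# 1) (# 3) (# 4) (λ ()) (λ ()) (λ ()) e₁ e₃ e₄
... | inj₂ e₀ | inj₁ _  | inj₂ e₂ | inj₂ e₃ | _       = coincidence (# 0) (# 2) (# 3) (λ ()) (λ ()) (λ ()) e₀ e₂ e₃
... | inj₂ e₀ | inj₁ _  | inj₂ e₂ | inj₁ _  | inj₂ e₄ = coincidence (# 0) (# 2) (# 4) (λ ()) (λ ()) (λ ()) e₀ e₂ e₄
... | inj₂ _  | inj₁ e₁ | inj₂ _  | inj₁ e₃ | inj₁ e₄ = coincidence (# 1) (# 3) (# 4) (λ ()) (λ ()) (λ ()) e₁ e₃ e₄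
... | inj₂ _  | inj₁ e₁ | inj₁ e₂ | inj₁ e₃ | _       = coincidence (# 1) (# 2) (# 3) (λ ()) (λ ()) (λ ()) e₁ e₂ e₃
... | inj₂ _  | inj₁ e₁ | inj₁ e₂ | inj₂ _  | inj₁ e₄ = coincidence (# 1) (# 2) (# 4) (λ ()) (λ ()) (λ ()) e₁ e₂ e₄
... | inj₂ e₀ | inj₁ _  | inj₁ _  | inj₂ e₃ | inj₂ e₄ = coincidence (# 0) (# 3) (# 4) (λ ()) (λ ()) (λ ()) e₀ e₃ e₄
... | inj₁ _  | inj₂ e₁ | inj₂ e₂ | inj₂ e₃ | _       = coincidence (# 1) (# 2) (# 3) (λ ()) (λ ()) (λ ()) e₁ e₂ e₃
... | inj₁ _  | inj₂ e₁ | inj₂ e₂ | inj₁ _  | inj₂ e₄ = coincidence (# 1) (# 2) (# 4) (λ ()) (λ ()) (λ ()) e₁ e₂ e₄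
... | inj₁ e₀ | inj₂ _  | inj₂ _  | inj₁ e₃ | inj₁ e₄ = coincidence (# 0) (# 3) (# 4) (λ ()) (λ ()) (λ ()) e₀ e₃ e₄

module IntegralDomain
  {F : Set} {add mul : Op₂ F} {neg : Op₁ F} {zero# one# : F}
  (isCommutativeRing : IsCommutativeRing _≡_ add mul neg zero# one#)
  (zero-product : ∀ x y → mul x y ≡ zero# → x ≡ zero# ⊎ y ≡ zero#)
  where

  open IntegerEmbedding isCommutativeRing using (commutativeRing; solve; _:=_; _:+_; _:*_; _:-_; :-_; con)
  open CommutativeRing commutativeRing using (_+_; _*_; -_; _-_; 0#)
  open ≡-Reasoning

  x-y≡0⇒x≡y : ∀ {x y} → x - y ≡ 0# → x ≡ y
  x-y≡0⇒x≡y {x} {y} e = begin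
    x             ≡⟨ solve 2 (λ x y → x := (x :- y) :+ y) refl x y ⟩
    (x - y) + y   ≡⟨ cong (_+ y) e ⟩
    0# + y        ≡⟨ solve 1 (λ y → con 0ℤ :+ y := y) refl y ⟩
    y             ∎

  x≢y⇒x-y≢0 : ∀ {x y} → x ≢ y → x - y ≢ 0#
  x≢y⇒x-y≢0 x≢y e = x≢y (x-y≡0⇒x≡y e)

  *-≢0 : ∀ {x y} → x ≢ 0# → y ≢ 0# → x * y ≢ 0#
  *-≢0 {x} {y} x≢0 y≢0 e with zero-product x y e
  ... | inj₁ x≡0 = x≢0 x≡0
  ... | inj₂ y≡0 = y≢0 y≡0

  x*x≡0⇒x≡0 : ∀ {x} → x * x ≡ 0# → x ≡ 0#
  x*x≡0⇒x≡0 {x} e with zero-product x x e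
  ... | inj₁ x≡0 = x≡0
  ... | inj₂ x≡0 = x≡0

  *-cancelˡ : ∀ {x y z} → x ≢ 0# → x * y ≡ x * z → y ≡ z
  *-cancelˡ {x} {y} {z} x≢0 e with zero-product x (y - z) x[y-z]≡0
    where
    x[y-z]≡0 : x * (y - z) ≡ 0#
    x[y-z]≡0 = begin
      x * (y - z)       ≡⟨ solve 3 (λ x y z → x :* (y :- z) := x :* y :- x :* z) refl x y z ⟩
      x * y - x * z     ≡⟨ cong (_- x * z) e ⟩
      x * z - x * z     ≡⟨ solve 1 (λ t → t :- t := con 0ℤ) refl (x * z) ⟩
      0#                ∎
  ... | inj₁ x≡0   = ⊥-elim (x≢0 x≡0)
  ... | inj₂ y-z≡0 = x-y≡0⇒x≡y y-z≡0

  square-roots : ∀ {x y} → x * x ≡ y * y → x ≡ y ⊎ x ≡ - y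
  square-roots {x} {y} e with zero-product (x - y) (x + y) [x-y][x+y]≡0
    where
    [x-y][x+y]≡0 : (x - y) * (x + y) ≡ 0#
    [x-y][x+y]≡0 = begin
      (x - y) * (x + y)   ≡⟨ solve 2 (λ x y → (x :- y) :* (x :+ y) := x :* x :- y :* y) refl x y ⟩
      x * x - y * y       ≡⟨ cong (_- y * y) e ⟩
      y * y - y * y       ≡⟨ solve 1 (λ t → t :- t := con 0ℤ) refl (y * y) ⟩
      0#                  ∎
  ... | inj₁ x-y≡0 = inj₁ (x-y≡0⇒x≡y x-y≡0)
  ... | inj₂ x+y≡0 = inj₂ (x-y≡0⇒x≡y (trans (solve 2 (λ x y → x :- (:- y) := x :+ y) refl x y) x+y≡0))


module MomentCurve
  {F : Set} {add mul : Op₂ F} {neg : Op₁ F} {zero# one# : F}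
  (isCommutativeRing : IsCommutativeRing _≡_ add mul neg zero# one#)
  (_≟_ : DecidableEquality F)
  (zero-product : ∀ x y → mul x y ≡ zero# → x ≡ zero# ⊎ y ≡ zero#)
  (inverse : ∀ x → x ≢ zero# → ∃ λ y → mul x y ≡ one#)
  (1+1≢0 : add one# one# ≢ zero#)
  where

  open IntegerEmbedding isCommutativeRing using (commutativeRing; solve; _:=_; _:+_; _:*_; _:-_; :-_; con)
  open CommutativeRing commutativeRing public using (_+_; _*_; -_; _-_; 0#; 1#)
  open CommutativeRing commutativeRing using (*-identityˡ; *-identityʳ; distribʳ; zeroʳ; +-group)
  open import Algebra.Properties.Group +-group using (⁻¹-injective)
  open IntegralDomain isCommutativeRing zero-product
  open ≡-Reasoning

  double-injective : ∀ {x y} → x + x ≡ y + y → x ≡ y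
  double-injective {x} {y} e = *-cancelˡ 1+1≢0 (begin
    (1# + 1#) * x    ≡⟨ distribʳ x 1# 1# ⟩
    1# * x + 1# * x  ≡⟨ cong₂ _+_ (*-identityˡ x) (*-identityˡ x) ⟩
    x + x            ≡⟨ e ⟩
    y + y            ≡⟨ sym (cong₂ _+_ (*-identityˡ y) (*-identityˡ y)) ⟩
    1# * y + 1# * y  ≡⟨ sym (distribʳ y 1# 1#) ⟩
    (1# + 1#) * y    ∎)

  IsSquare : F → Set
  IsSquare x = ∃ λ y → y * y ≡ x

  square-quotient : ∀ {h g d u v w} → u * u ≡ h * d → v * v ≡ g * d → w * w ≡ g →
                    g ≢ 0# → d ≢ 0# → IsSquare h
  square-quotient {h} {g} {d} {u} {v} {w} uu vv ww g≢0 d≢0 with inverse v v≢0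
    where
    v≢0 : v ≢ 0#
    v≢0 v≡0 = *-≢0 g≢0 d≢0 (trans (sym vv) (trans (cong (λ t → t * t) v≡0) (solve 0 (con 0ℤ :* con 0ℤ := con 0ℤ) refl)))
  ... | v⁻¹ , vv⁻¹ = u * w * v⁻¹ , (begin
    (u * w * v⁻¹) * (u * w * v⁻¹)
      ≡⟨ solve 3 (λ u w i → (u :* w :* i) :* (u :* w :* i) := (u :* u) :* (w :* w) :* (i :* i)) refl u w v⁻¹ ⟩
    (u * u) * (w * w) * (v⁻¹ * v⁻¹)
      ≡⟨ cong₂ (λ s t → s * t * (v⁻¹ * v⁻¹)) uu ww ⟩
    (h * d) * g * (v⁻¹ * v⁻¹)
      ≡⟨ solve 4 (λ h d g i → (h :* d) :* g :* (i :* i) := h :* ((g :* d) :* (i :* i))) refl h d g v⁻¹ ⟩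
    h * ((g * d) * (v⁻¹ * v⁻¹))
      ≡⟨ cong (λ t → h * (t * (v⁻¹ * v⁻¹))) (sym vv) ⟩
    h * ((v * v) * (v⁻¹ * v⁻¹))
      ≡⟨ cong (h *_) (solve 2 (λ v i → (v :* v) :* (i :* i) := (v :* i) :* (v :* i)) refl v v⁻¹) ⟩
    h * ((v * v⁻¹) * (v * v⁻¹))
      ≡⟨ cong (λ t → h * (t * t)) vv⁻¹ ⟩
    h * (1# * 1#)
      ≡⟨ cong (h *_) (*-identityˡ 1#) ⟩
    h * 1#
      ≡⟨ *-identityʳ h ⟩
    h ∎)

  Point : Set
  Point = F × F

  move : F → F → Point → Point
  move s a (x₁ , x₂) = (x₁ + s * a , x₂ + s * (a * a))

  line : Point → F → F → Point
  line o c κ = move κ c o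

  disc : F → Point → F → Point → F
  disc κ x μ x' = (μ - κ) * (proj₂ x' - proj₂ x) - (proj₁ x' - proj₁ x) * (proj₁ x' - proj₁ x)

  move⁻¹ : ∀ {x y} s a → y ≡ move s a x → x ≡ move (- s) a y
  move⁻¹ {x₁ , x₂} s a refl = cong₂ _,_
    (solve 3 (λ x s a → x := (x :+ s :* a) :+ (:- s) :* a) refl x₁ s a)
    (solve 3 (λ x s a → x := (x :+ s :* (a :* a)) :+ (:- s) :* (a :* a)) refl x₂ s a)

  common-step-difference : ∀ {s r a b x x' y} → y ≡ move s a x → y ≡ move r b x' →
    proj₁ x' - proj₁ x ≡ s * a - r * b × proj₂ x' - proj₂ x ≡ s * (a * a) - r * (b * b)
  common-step-difference {s} {r} {a} {b} {y = y₁ , y₂} e e'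
    rewrite move⁻¹ s a e | move⁻¹ r b e' =
      solve 5 (λ y s r a b → (y :+ (:- r) :* b) :- (y :+ (:- s) :* a) := s :* a :- r :* b) refl y₁ s r a b ,
      solve 5 (λ y s r a b → (y :+ (:- r) :* (b :* b)) :- (y :+ (:- s) :* (a :* a)) := s :* (a :* a) :- r :* (b :* b)) refl y₂ s r a b

  Step : F → Point → F → Point → Set
  Step κ x μ y = ∃ λ a → y ≡ move (μ - κ) a x

  cross : F → F → F → F
  cross κ μ ν = (ν - κ) * (μ - ν)

  disc-common-step : ∀ {κ μ ν a b x x' y} → y ≡ move (ν - κ) a x → y ≡ move (ν - μ) b x' →
    ((ν - κ) * (ν - μ) * (a - b)) * ((ν - κ) * (ν - μ) * (a - b)) ≡ cross κ μ ν * disc κ x μ x'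
  disc-common-step {κ} {μ} {ν} {a} {b} {x} {x'} e e' = begin
    ((ν - κ) * (ν - μ) * (a - b)) * ((ν - κ) * (ν - μ) * (a - b))
      ≡⟨ solve 5 (λ κ μ ν a b →
           ((ν :- κ) :* (ν :- μ) :* (a :- b)) :* ((ν :- κ) :* (ν :- μ) :* (a :- b))
           := ((ν :- κ) :* (μ :- ν)) :* ((μ :- κ) :* ((ν :- κ) :* (a :* a) :- (ν :- μ) :* (b :* b))
                :- ((ν :- κ) :* a :- (ν :- μ) :* b) :* ((ν :- κ) :* a :- (ν :- μ) :* b)))
           refl κ μ ν a b ⟩
    cross κ μ ν * ((μ - κ) * ((ν - κ) * (a * a) - (ν - μ) * (b * b)) - ((ν - κ) * a - (ν - μ) * b) * ((ν - κ) * a - (ν - μ) * b))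
      ≡⟨ cong₂ (λ u v → cross κ μ ν * ((μ - κ) * u - v * v)) (sym (proj₂ d)) (sym (proj₁ d)) ⟩
    cross κ μ ν * disc κ x μ x' ∎
    where d = common-step-difference e e'

  common-step-square : ∀ {κ μ ν x x' y} → Step κ x ν y → Step μ x' ν y → IsSquare (cross κ μ ν * disc κ x μ x')
  common-step-square (a , e) (b , e') = _ , disc-common-step e e'

  common-step-same-level : ∀ {κ ν x x' y z} → κ ≢ ν →
    Step κ x ν y → Step κ x' ν y → Step κ x ν z → Step κ x' ν z → y ≡ z ⊎ x ≡ x'
  common-step-same-level {κ} {ν} {x} {x'} {y} {z} κ≢ν (a , ey) (b , ey') (a' , ez) (b' , ez') with a ≟ b
  ... | yes refl = inj₂ (trans (move⁻¹ s a ey) (sym (move⁻¹ s a ey')))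
    where s = ν - κ
  ... | no a≢b = inj₁ (trans ey (trans (cong (λ t → move s t x) a≡a') (sym ez)))
    where
    s = ν - κ
    s≢0 : s ≢ 0#
    s≢0 = x≢y⇒x-y≢0 (≢-sym κ≢ν)
    dy = common-step-difference ey ey'
    dz = common-step-difference ez ez'
    a-b≡a'-b' : a - b ≡ a' - b'
    a-b≡a'-b' = *-cancelˡ s≢0 (begin
      s * (a - b)            ≡⟨ solve 3 (λ s a b → s :* (a :- b) := s :* a :- s :* b) refl s a b ⟩
      s * a - s * b          ≡⟨ trans (sym (proj₁ dy)) (proj₁ dz) ⟩
      s * a' - s * b'        ≡⟨ solve 3 (λ s a b → s :* a :- s :* b := s :* (a :- b)) refl s a' b' ⟩
      s * (a' - b')          ∎)
    a+b≡a'+b' : a + b ≡ a' + b'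
    a+b≡a'+b' = *-cancelˡ (*-≢0 s≢0 (x≢y⇒x-y≢0 a≢b)) (begin
      s * (a - b) * (a + b)
        ≡⟨ solve 3 (λ s a b → s :* (a :- b) :* (a :+ b) := s :* (a :* a) :- s :* (b :* b)) refl s a b ⟩
      s * (a * a) - s * (b * b)
        ≡⟨ trans (sym (proj₂ dy)) (proj₂ dz) ⟩
      s * (a' * a') - s * (b' * b')
        ≡⟨ solve 3 (λ s a b → s :* (a :* a) :- s :* (b :* b) := s :* (a :- b) :* (a :+ b)) refl s a' b' ⟩
      s * (a' - b') * (a' + b')
        ≡⟨ cong (λ t → s * t * (a' + b')) (sym a-b≡a'-b') ⟩
      s * (a - b) * (a' + b') ∎)
    a≡a' : a ≡ a'
    a≡a' = double-injective (begin
      a + a                   ≡⟨ solve 2 (λ a b → a :+ a := (a :- b) :+ (a :+ b)) refl a b ⟩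
      (a - b) + (a + b)       ≡⟨ cong₂ _+_ a-b≡a'-b' a+b≡a'+b' ⟩
      (a' - b') + (a' + b')   ≡⟨ solve 2 (λ a b → (a :- b) :+ (a :+ b) := a :+ a) refl a' b' ⟩
      a' + a'                 ∎)

  common-step-coefficient : ∀ {κ μ ν a b x x' y} → y ≡ move (ν - κ) a x → y ≡ move (ν - μ) b x' →
    (μ - κ) * a ≡ (proj₁ x' - proj₁ x) - (ν - μ) * (a - b)
  common-step-coefficient {κ} {μ} {ν} {a} {b} {x} {x'} e e' = begin
    (μ - κ) * a
      ≡⟨ solve 5 (λ κ μ ν a b → (μ :- κ) :* a := ((ν :- κ) :* a :- (ν :- μ) :* b) :- (ν :- μ) :* (a :- b)) refl κ μ ν a b ⟩
    ((ν - κ) * a - (ν - μ) * b) - (ν - μ) * (a - b)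
      ≡⟨ cong (_- (ν - μ) * (a - b)) (sym (proj₁ (common-step-difference e e'))) ⟩
    (proj₁ x' - proj₁ x) - (ν - μ) * (a - b) ∎

  common-step-unique : ∀ {κ μ ν a b a' b' x x' y z} → κ ≢ μ →
    y ≡ move (ν - κ) a x → y ≡ move (ν - μ) b x' → z ≡ move (ν - κ) a' x → z ≡ move (ν - μ) b' x' →
    a - b ≡ a' - b' → y ≡ z
  common-step-unique {κ} {μ} {ν} {a} {b} {a'} {b'} {x} {x'} κ≢μ ey ey' ez ez' a-b≡a'-b' =
    trans ey (trans (cong (λ t → move (ν - κ) t x) a≡a') (sym ez))
    where
    a≡a' : a ≡ a'
    a≡a' = *-cancelˡ (x≢y⇒x-y≢0 (≢-sym κ≢μ)) (begin
      (μ - κ) * a                                ≡⟨ common-step-coefficient ey ey' ⟩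
      (proj₁ x' - proj₁ x) - (ν - μ) * (a - b)   ≡⟨ cong (λ t → (proj₁ x' - proj₁ x) - (ν - μ) * t) a-b≡a'-b' ⟩
      (proj₁ x' - proj₁ x) - (ν - μ) * (a' - b') ≡⟨ sym (common-step-coefficient ez ez') ⟩
      (μ - κ) * a'                               ∎)

  -- Y = (ν − κ)(ν − μ)(a − b) determines the common step and Y² = cross κ μ ν · disc κ x μ x' does
  -- not depend on it, so there are at most two values of Y.
  at-most-two-common-steps : ∀ {κ μ ν x x' y z w} → κ ≢ μ → ν ≢ κ → ν ≢ μ →
    Step κ x ν y → Step μ x' ν y → Step κ x ν z → Step μ x' ν z → Step κ x ν w → Step μ x' ν w →
    y ≡ z ⊎ y ≡ w ⊎ z ≡ w
  at-most-two-common-steps {κ} {μ} {ν} {y = y} {z} {w} κ≢μ ν≢κ ν≢μ (a , ey) (b , ey') (a' , ez) (b' , ez') (a'' , ew) (b'' , ew') =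
    conclude (square-roots (trans (disc-common-step ey ey') (sym (disc-common-step ez ez'))))
             (square-roots (trans (disc-common-step ey ey') (sym (disc-common-step ew ew'))))
    where
    c : F
    c = (ν - κ) * (ν - μ)
    cancel : ∀ {u v} → c * u ≡ c * v → u ≡ v
    cancel = *-cancelˡ (*-≢0 (x≢y⇒x-y≢0 ν≢κ) (x≢y⇒x-y≢0 ν≢μ))
    conclude : c * (a - b) ≡ c * (a' - b') ⊎ c * (a - b) ≡ - (c * (a' - b')) →
               c * (a - b) ≡ c * (a'' - b'') ⊎ c * (a - b) ≡ - (c * (a'' - b'')) →
               y ≡ z ⊎ y ≡ w ⊎ z ≡ w
    conclude (inj₁ Yy≡Yz)  _              = inj₁ (common-step-unique κ≢μ ey ey' ez ez' (cancel Yy≡Yz))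
    conclude (inj₂ _)      (inj₁ Yy≡Yw)   = inj₂ (inj₁ (common-step-unique κ≢μ ey ey' ew ew' (cancel Yy≡Yw)))
    conclude (inj₂ Yy≡-Yz) (inj₂ Yy≡-Yw)  =
      inj₂ (inj₂ (common-step-unique κ≢μ ez ez' ew ew' (cancel (⁻¹-injective (trans (sym Yy≡-Yz) Yy≡-Yw)))))

  line-step : ∀ o c κ μ → line o c μ ≡ move (μ - κ) c (line o c κ)
  line-step (o₁ , o₂) c κ μ = cong₂ _,_
    (solve 4 (λ o c κ μ → o :+ μ :* c := (o :+ κ :* c) :+ (μ :- κ) :* c) refl o₁ c κ μ)
    (solve 4 (λ o c κ μ → o :+ μ :* (c :* c) := (o :+ κ :* (c :* c)) :+ (μ :- κ) :* (c :* c)) refl o₂ c κ μ)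

  step-on-line : ∀ {κ μ a x y} → y ≡ move (μ - κ) a x → x ≡ line (move (- κ) a x) a κ × y ≡ line (move (- κ) a x) a μ
  step-on-line {κ} {μ} {a} {x₁ , x₂} refl =
    cong₂ _,_ (solve 3 (λ x κ a → x := (x :+ (:- κ) :* a) :+ κ :* a) refl x₁ κ a)
              (solve 3 (λ x κ a → x := (x :+ (:- κ) :* (a :* a)) :+ κ :* (a :* a)) refl x₂ κ a) ,
    cong₂ _,_ (solve 4 (λ x κ μ a → x :+ (μ :- κ) :* a := (x :+ (:- κ) :* a) :+ μ :* a) refl x₁ κ μ a)
              (solve 4 (λ x κ μ a → x :+ (μ :- κ) :* (a :* a) := (x :+ (:- κ) :* (a :* a)) :+ μ :* (a :* a)) refl x₂ κ μ a)

  line-injective : ∀ {o o' c c' κ μ} → κ ≢ μ → line o c κ ≡ line o' c' κ → line o c μ ≡ line o' c' μ → o ≡ o' × c ≡ c'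
  line-injective {o₁ , o₂} {o₁' , o₂'} {c} {c'} {κ} {μ} κ≢μ eκ eμ =
    trans (move⁻¹ κ c refl) (trans (cong₂ (move (- κ)) c≡c' eκ) (sym (move⁻¹ κ c' refl))) , c≡c'
    where
    c≡c' : c ≡ c'
    c≡c' = *-cancelˡ (x≢y⇒x-y≢0 (≢-sym κ≢μ)) (begin
      (μ - κ) * c                          ≡⟨ solve 4 (λ o c κ μ → (μ :- κ) :* c := (o :+ μ :* c) :- (o :+ κ :* c)) refl o₁ c κ μ ⟩
      (o₁ + μ * c) - (o₁ + κ * c)          ≡⟨ cong₂ _-_ (proj₁ (,-injective eμ)) (proj₁ (,-injective eκ)) ⟩
      (o₁' + μ * c') - (o₁' + κ * c')      ≡⟨ solve 4 (λ o c κ μ → (o :+ μ :* c) :- (o :+ κ :* c) := (μ :- κ) :* c) refl o₁' c' κ μ ⟩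
      (μ - κ) * c'                         ∎)

  disc-line : ∀ o c κ μ → disc κ (line o c κ) μ (line o c μ) ≡ 0#
  disc-line (o₁ , o₂) c κ μ = solve 5 (λ o₁ o₂ c κ μ →
    (μ :- κ) :* ((o₂ :+ μ :* (c :* c)) :- (o₂ :+ κ :* (c :* c))) :- ((o₁ :+ μ :* c) :- (o₁ :+ κ :* c)) :* ((o₁ :+ μ :* c) :- (o₁ :+ κ :* c))
    := con 0ℤ) refl o₁ o₂ c κ μ

  disc≡0⇒step : ∀ {κ μ x x'} → κ ≢ μ → disc κ x μ x' ≡ 0# → Step κ x μ x'
  disc≡0⇒step {κ} {μ} {x₁ , x₂} {x₁' , x₂'} κ≢μ disc≡0 with inverse (μ - κ) (x≢y⇒x-y≢0 (≢-sym κ≢μ))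
  ... | m⁻¹ , mm⁻¹ = d₁ * m⁻¹ , sym (cong₂ _,_ first second)
    where
    m = μ - κ
    d₁ = x₁' - x₁
    d₂ = x₂' - x₂
    md₂≡d₁d₁ : m * d₂ ≡ d₁ * d₁
    md₂≡d₁d₁ = x-y≡0⇒x≡y disc≡0
    first : x₁ + m * (d₁ * m⁻¹) ≡ x₁'
    first = begin
      x₁ + m * (d₁ * m⁻¹)   ≡⟨ solve 4 (λ x d m i → x :+ m :* (d :* i) := x :+ d :* (m :* i)) refl x₁ d₁ m m⁻¹ ⟩
      x₁ + d₁ * (m * m⁻¹)   ≡⟨ cong (λ t → x₁ + d₁ * t) mm⁻¹ ⟩
      x₁ + d₁ * 1#          ≡⟨ cong (x₁ +_) (*-identityʳ d₁) ⟩
      x₁ + (x₁' - x₁)       ≡⟨ solve 2 (λ x x' → x :+ (x' :- x) := x') refl x₁ x₁' ⟩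
      x₁'                   ∎
    second : x₂ + m * ((d₁ * m⁻¹) * (d₁ * m⁻¹)) ≡ x₂'
    second = begin
      x₂ + m * ((d₁ * m⁻¹) * (d₁ * m⁻¹))
        ≡⟨ solve 4 (λ x d m i → x :+ m :* ((d :* i) :* (d :* i)) := x :+ (d :* d) :* i :* (m :* i)) refl x₂ d₁ m m⁻¹ ⟩
      x₂ + (d₁ * d₁) * m⁻¹ * (m * m⁻¹)
        ≡⟨ cong₂ (λ s t → x₂ + s * m⁻¹ * t) (sym md₂≡d₁d₁) mm⁻¹ ⟩
      x₂ + (m * d₂) * m⁻¹ * 1#
        ≡⟨ cong (x₂ +_) (*-identityʳ _) ⟩
      x₂ + (m * d₂) * m⁻¹
        ≡⟨ solve 4 (λ x d m i → x :+ (m :* d) :* i := x :+ d :* (m :* i)) refl x₂ d₂ m m⁻¹ ⟩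
      x₂ + d₂ * (m * m⁻¹)
        ≡⟨ cong (λ t → x₂ + d₂ * t) mm⁻¹ ⟩
      x₂ + d₂ * 1#
        ≡⟨ cong (x₂ +_) (*-identityʳ d₂) ⟩
      x₂ + (x₂' - x₂)
        ≡⟨ solve 2 (λ x x' → x :+ (x' :- x) := x') refl x₂ x₂' ⟩
      x₂' ∎

  common-step-on-line : ∀ {o c κ μ ν y} → κ ≢ μ → ν ≢ κ → ν ≢ μ →
    Step κ (line o c κ) ν y → Step μ (line o c μ) ν y → y ≡ line o c ν
  common-step-on-line {o@(o₁ , o₂)} {c} {κ} {μ} {ν} κ≢μ ν≢κ ν≢μ (a , e) (b , e') = begin
    _                             ≡⟨ e ⟩
    move (ν - κ) a (line o c κ)   ≡⟨ cong (λ t → move (ν - κ) t (line o c κ)) a≡c ⟩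
    move (ν - κ) c (line o c κ)   ≡⟨ sym (line-step o c κ ν) ⟩
    line o c ν                    ∎
    where
    Y≡0 : (ν - κ) * (ν - μ) * (a - b) ≡ 0#
    Y≡0 = x*x≡0⇒x≡0 (begin
      _                                ≡⟨ disc-common-step e e' ⟩
      cross κ μ ν * disc κ (line o c κ) μ (line o c μ)  ≡⟨ cong (cross κ μ ν *_) (disc-line o c κ μ) ⟩
      cross κ μ ν * 0#                 ≡⟨ solve 1 (λ h → h :* con 0ℤ := con 0ℤ) refl (cross κ μ ν) ⟩
      0#                               ∎)
    a-b≡0 : a - b ≡ 0#
    a-b≡0 = *-cancelˡ (*-≢0 (x≢y⇒x-y≢0 ν≢κ) (x≢y⇒x-y≢0 ν≢μ)) (trans Y≡0 (sym (zeroʳ _)))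
    a≡c : a ≡ c
    a≡c = *-cancelˡ (x≢y⇒x-y≢0 (≢-sym κ≢μ)) (begin
      (μ - κ) * a
        ≡⟨ common-step-coefficient e e' ⟩
      ((o₁ + μ * c) - (o₁ + κ * c)) - (ν - μ) * (a - b)
        ≡⟨ cong (λ t → ((o₁ + μ * c) - (o₁ + κ * c)) - (ν - μ) * t) a-b≡0 ⟩
      ((o₁ + μ * c) - (o₁ + κ * c)) - (ν - μ) * 0#
        ≡⟨ solve 5 (λ o c κ μ ν → ((o :+ μ :* c) :- (o :+ κ :* c)) :- (ν :- μ) :* con 0ℤ := (μ :- κ) :* c) refl o₁ c κ μ ν ⟩
      (μ - κ) * c ∎)

  step-sym : ∀ {κ μ x y} → Step κ x μ y → Step μ y κ x
  step-sym {κ} {μ} {x} {y} (a , e) =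
    a , trans (move⁻¹ (μ - κ) a e) (cong (λ s → move s a y) (solve 2 (λ κ μ → :- (μ :- κ) := κ :- μ) refl κ μ))

  cross-sym : ∀ κ μ ν → cross κ μ ν ≡ cross μ κ ν
  cross-sym κ μ ν = solve 3 (λ κ μ ν → (ν :- κ) :* (μ :- ν) := (ν :- μ) :* (κ :- ν)) refl κ μ ν

  module ParabolaGraph {I : Set} (_≟I_ : DecidableEquality I) (E : I → I → Set)
    (E-irrefl : ∀ {i j} → E i j → i ≢ j) (L : I → F) (L-injective : ∀ {i j} → i ≢ j → L i ≢ L j) where

    Vertex : Set
    Vertex = Point × I

    Adj : Vertex → Vertex → Set
    Adj (x , i) (y , j) = E i j × Step (L i) x (L j) y

    Common : Vertex → Vertex → Vertex → Set
    Common P Q w = Adj P w × Adj Q w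

    lineV : Point → F → I → Vertex
    lineV o c i = line o c (L i) , i

    OnLine : Point → F → Vertex → Set
    OnLine o c (x , i) = x ≡ line o c (L i)

    crossV : Vertex → Vertex → I → F
    crossV (_ , α) (_ , β) j = cross (L α) (L β) (L j)

    E⇒L≢ : ∀ {i j} → E i j → L j ≢ L i
    E⇒L≢ e = L-injective (≢-sym (E-irrefl e))

    common-neighbours-same-part : ∀ {P Q w w'} → P ≢ Q → proj₂ P ≡ proj₂ Q → proj₂ w ≡ proj₂ w' →
      Common P Q w → Common P Q w' → w ≡ w'
    common-neighbours-same-part {x , α} {x' , .α} {y , j} {z , .j} P≢Q refl refl ((e , sy) , (_ , sy')) ((_ , sz) , (_ , sz'))
      with common-step-same-level (≢-sym (E⇒L≢ e)) sy sy' sz sz'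
    ... | inj₁ y≡z  = cong (_, j) y≡z
    ... | inj₂ x≡x' = ⊥-elim (P≢Q (cong (_, α) x≡x'))

    at-most-two-common-neighbours : ∀ {P Q w₁ w₂ w₃} → P ≢ Q → proj₂ w₁ ≡ proj₂ w₂ → proj₂ w₁ ≡ proj₂ w₃ →
      Common P Q w₁ → Common P Q w₂ → Common P Q w₃ → w₁ ≡ w₂ ⊎ w₁ ≡ w₃ ⊎ w₂ ≡ w₃
    at-most-two-common-neighbours {x , α} {x' , β} {y₁ , j} {y₂ , .j} {y₃ , .j} P≢Q refl refl c₁ c₂ c₃ with α ≟I β
    ... | yes refl = inj₁ (common-neighbours-same-part P≢Q refl refl c₁ c₂)
    ... | no α≢β   = vertices (at-most-two-common-steps (L-injective α≢β) (E⇒L≢ (proj₁ (proj₁ c₁))) (E⇒L≢ (proj₁ (proj₂ c₁)))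
                                 (proj₂ (proj₁ c₁)) (proj₂ (proj₂ c₁)) (proj₂ (proj₁ c₂)) (proj₂ (proj₂ c₂))
                                 (proj₂ (proj₁ c₃)) (proj₂ (proj₂ c₃)))
      where
      vertices : y₁ ≡ y₂ ⊎ y₁ ≡ y₃ ⊎ y₂ ≡ y₃ → (y₁ , j) ≡ (y₂ , j) ⊎ (y₁ , j) ≡ (y₃ , j) ⊎ (y₂ , j) ≡ (y₃ , j)
      vertices (inj₁ e)        = inj₁ (cong (_, j) e)
      vertices (inj₂ (inj₁ e)) = inj₂ (inj₁ (cong (_, j) e))
      vertices (inj₂ (inj₂ e)) = inj₂ (inj₂ (cong (_, j) e))

    no-five-common-neighbours : ∀ {P Q c d} (w : Fin 5 → Vertex) → P ≢ Q → (∀ {t t'} → w t ≡ w t' → t ≡ t') →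
      (∀ t → Common P Q (w t)) → ¬ (∀ t → proj₂ (w t) ≡ c ⊎ proj₂ (w t) ≡ d)
    no-five-common-neighbours w P≢Q w-injective common two-parts
      with three-of-five (λ t → proj₂ (w t)) two-parts
    ... | coincide t₀ t₁ t₂ t₀≢t₁ t₀≢t₂ t₁≢t₂ e₀₁ e₀₂
      with at-most-two-common-neighbours P≢Q e₀₁ e₀₂ (common t₀) (common t₁) (common t₂)
    ... | inj₁ eq        = t₀≢t₁ (w-injective eq)
    ... | inj₂ (inj₁ eq) = t₀≢t₂ (w-injective eq)
    ... | inj₂ (inj₂ eq) = t₁≢t₂ (w-injective eq)

    common-neighbour-on-line : ∀ {o c P Q w} → OnLine o c P → OnLine o c Q → proj₂ P ≢ proj₂ Q →
      Common P Q w → OnLine o c w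
    common-neighbour-on-line {P = _ , α} {_ , β} {_ , j} refl refl α≢β ((eα , s) , (eβ , s')) =
      common-step-on-line (L-injective α≢β) (E⇒L≢ eα) (E⇒L≢ eβ) s s'

    same-part-on-line : ∀ {o c v w} → OnLine o c v → OnLine o c w → proj₂ v ≡ proj₂ w → v ≡ w
    same-part-on-line {v = _ , i} refl refl refl = refl

    NonzeroSquare : F → Set
    NonzeroSquare x = x ≢ 0# × IsSquare x

    -- If disc ≢ 0, a common neighbour in a part with a nonzero square cross value would make the cross
    -- value of u a square as well, so all five common neighbours w would lie in the two parts c and d.
    collinear : ∀ {P Q u c d} (w : Fin 5 → Vertex) → proj₂ P ≢ proj₂ Q →
      Common P Q u → ¬ IsSquare (crossV P Q (proj₂ u)) →
      (∀ {v} → Common P Q v → (proj₂ v ≡ c ⊎ proj₂ v ≡ d) ⊎ NonzeroSquare (crossV P Q (proj₂ v))) →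
      (∀ {t t'} → w t ≡ w t' → t ≡ t') → (∀ t → Common P Q (w t)) →
      ∃₂ λ o c' → OnLine o c' P × OnLine o c' Q
    collinear {P@(x , α)} {Q@(x' , β)} {u} {c} {d} w α≢β common-u u-nonsquare classify w-injective common
      with disc (L α) x (L β) x' ≟ 0#
    ... | yes disc≡0 = _ , _ , step-on-line (proj₂ (disc≡0⇒step (L-injective α≢β) disc≡0))
    ... | no disc≢0  = ⊥-elim (no-five-common-neighbours w (λ P≡Q → α≢β (cong proj₂ P≡Q)) w-injective common two-parts)
      where
      two-parts : ∀ t → proj₂ (w t) ≡ c ⊎ proj₂ (w t) ≡ d
      two-parts t with classify (common t)
      ... | inj₁ in-two-parts = in-two-parts
      ... | inj₂ (cross≢0 , square) = ⊥-elim (u-nonsquare (square-quotient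
              (proj₂ (common-step-square (proj₂ (proj₁ common-u)) (proj₂ (proj₂ common-u))))
              (proj₂ (common-step-square (proj₂ (proj₁ (common t))) (proj₂ (proj₂ (common t)))))
              (proj₂ square) cross≢0 disc≢0))

    OnLine⇒lineV : ∀ {o c v} → OnLine o c v → v ≡ lineV o c (proj₂ v)
    OnLine⇒lineV {v = _ , i} refl = refl

    shared-edge⇒same-line : ∀ {o c o' c' a b a' b'} → E a b →
      lineV o c a ≡ lineV o' c' a' → lineV o c b ≡ lineV o' c' b' → o ≡ o' × c ≡ c'
    shared-edge⇒same-line e ea eb with ,-injective ea | ,-injective eb
    ... | same-a , refl | same-b , refl = line-injective (L-injective (E-irrefl e)) same-a same-b

-- ℕ's _+_ and _*_ come into scope only here, after the modules that use these names for ring operations.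
open import Data.Nat using (_*_; _+_)

injective⇒surjective : ∀ {n} (f : Fin n → Fin n) → (∀ {a b} → f a ≡ f b → a ≡ b) → ∀ y → ∃ λ x → f x ≡ y
injective⇒surjective {zero}  f f-inj ()
injective⇒surjective {suc n} f f-inj y with any? (λ x → f x ≟F y)
... | yes hit = hit
... | no miss = ⊥-elim (ℕ.<-irrefl refl (injective⇒≤ g-inj))
  where
  g : Fin (suc n) → Fin n
  g x = punchOut {i = y} {j = f x} (λ y≡fx → miss (x , sym y≡fx))
  g-inj : ∀ {a b} → g a ≡ g b → a ≡ b
  g-inj {a} {b} ga≡gb = f-inj (punchOut-injective (λ e → miss (a , sym e)) (λ e → miss (b , sym e)) ga≡gb)

module PrimeField (p : ℕ) (pr : Prime p) where

  open import Data.Nat.DivMod using (_mod_; m%n<n; m<n⇒m%n≡m; n%n≡0; %-distribˡ-+; %-distribˡ-*)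
  open import Data.Nat.Divisibility using (_∣_; ∣⇒≤; m%n≡0⇒n∣m)
  open import Data.Nat.Primality using (prime⇒nonZero; euclidsLemma)

  open Fp p pr
  open ≡-Reasoning

  private instance
    p≢0 : NonZero p
    p≢0 = prime⇒nonZero pr

  [_] : ℕ → F
  [ n ] = n mod p

  toℕ-[] : ∀ n → toℕ [ n ] ≡ n % p
  toℕ-[] n = toℕ-fromℕ< (m%n<n n p)

  [toℕ] : ∀ x → [ toℕ x ] ≡ x
  [toℕ] x = toℕ-injective (trans (toℕ-[] (toℕ x)) (m<n⇒m%n≡m (toℕ<n x)))

  []-cong : ∀ {m n} → m % p ≡ n % p → [ m ] ≡ [ n ]
  []-cong {m} {n} eq = toℕ-injective (trans (toℕ-[] m) (trans eq (sym (toℕ-[] n))))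

  [+] : ∀ m n → [ m ] +F [ n ] ≡ [ m + n ]
  [+] m n = []-cong (begin
    (toℕ [ m ] + toℕ [ n ]) % p   ≡⟨ cong₂ (λ a b → (a + b) % p) (toℕ-[] m) (toℕ-[] n) ⟩
    (m % p + n % p) % p           ≡⟨ sym (%-distribˡ-+ m n p) ⟩
    (m + n) % p                   ∎)

  [*] : ∀ m n → [ m ] *F [ n ] ≡ [ m * n ]
  [*] m n = []-cong (begin
    (toℕ [ m ] * toℕ [ n ]) % p   ≡⟨ cong₂ (λ a b → (a * b) % p) (toℕ-[] m) (toℕ-[] n) ⟩
    (m % p * (n % p)) % p         ≡⟨ sym (%-distribˡ-* m n p) ⟩
    (m * n) % p                   ∎)

  negF : F → F
  negF x = [ p ∸ toℕ x ]

  -- The ring laws are transported from ℕ along [_], which preserves _+_ and _*_.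
  +F-assoc : ∀ x y z → (x +F y) +F z ≡ x +F (y +F z)
  +F-assoc x y z = begin
    [ a + b ] +F z        ≡⟨ cong ([ a + b ] +F_) (sym ([toℕ] z)) ⟩
    [ a + b ] +F [ c ]    ≡⟨ [+] (a + b) c ⟩
    [ a + b + c ]         ≡⟨ cong [_] (ℕ.+-assoc a b c) ⟩
    [ a + (b + c) ]       ≡⟨ sym ([+] a (b + c)) ⟩
    [ a ] +F (y +F z)     ≡⟨ cong (_+F (y +F z)) ([toℕ] x) ⟩
    x +F (y +F z)         ∎
    where a = toℕ x; b = toℕ y; c = toℕ z

  *F-assoc : ∀ x y z → (x *F y) *F z ≡ x *F (y *F z)
  *F-assoc x y z = begin
    [ a * b ] *F z        ≡⟨ cong ([ a * b ] *F_) (sym ([toℕ] z)) ⟩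
    [ a * b ] *F [ c ]    ≡⟨ [*] (a * b) c ⟩
    [ a * b * c ]         ≡⟨ cong [_] (ℕ.*-assoc a b c) ⟩
    [ a * (b * c) ]       ≡⟨ sym ([*] a (b * c)) ⟩
    [ a ] *F (y *F z)     ≡⟨ cong (_*F (y *F z)) ([toℕ] x) ⟩
    x *F (y *F z)         ∎
    where a = toℕ x; b = toℕ y; c = toℕ z

  *F-distribˡ : ∀ x y z → x *F (y +F z) ≡ (x *F y) +F (x *F z)
  *F-distribˡ x y z = begin
    x *F [ b + c ]          ≡⟨ cong (_*F [ b + c ]) (sym ([toℕ] x)) ⟩
    [ a ] *F [ b + c ]      ≡⟨ [*] a (b + c) ⟩
    [ a * (b + c) ]         ≡⟨ cong [_] (ℕ.*-distribˡ-+ a b c) ⟩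
    [ a * b + a * c ]       ≡⟨ sym ([+] (a * b) (a * c)) ⟩
    (x *F y) +F (x *F z)    ∎
    where a = toℕ x; b = toℕ y; c = toℕ z

  +F-identityˡ : ∀ x → 0F +F x ≡ x
  +F-identityˡ x = begin
    0F +F x          ≡⟨ cong (0F +F_) (sym ([toℕ] x)) ⟩
    [ 0 ] +F [ a ]   ≡⟨ [+] 0 a ⟩
    [ a ]            ≡⟨ [toℕ] x ⟩
    x                ∎
    where a = toℕ x

  *F-identityˡ : ∀ x → 1F *F x ≡ x
  *F-identityˡ x = begin
    1F *F x          ≡⟨ cong (1F *F_) (sym ([toℕ] x)) ⟩
    [ 1 ] *F [ a ]   ≡⟨ [*] 1 a ⟩
    [ 1 * a ]        ≡⟨ cong [_] (ℕ.*-identityˡ a) ⟩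
    [ a ]            ≡⟨ [toℕ] x ⟩
    x                ∎
    where a = toℕ x

  +F-inverseʳ : ∀ x → x +F negF x ≡ 0F
  +F-inverseʳ x = begin
    x +F negF x              ≡⟨ cong (_+F negF x) (sym ([toℕ] x)) ⟩
    [ a ] +F [ p ∸ a ]       ≡⟨ [+] a (p ∸ a) ⟩
    [ a + (p ∸ a) ]          ≡⟨ cong [_] (ℕ.m+[n∸m]≡n (ℕ.<⇒≤ (toℕ<n x))) ⟩
    [ p ]                    ≡⟨ []-cong (trans (n%n≡0 p) (sym (m<n⇒m%n≡m (ℕ.>-nonZero⁻¹ p)))) ⟩
    [ 0 ]                    ∎
    where a = toℕ x

  +F-comm : ∀ x y → x +F y ≡ y +F x
  +F-comm x y = cong [_] (ℕ.+-comm (toℕ x) (toℕ y))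

  *F-comm : ∀ x y → x *F y ≡ y *F x
  *F-comm x y = cong [_] (ℕ.*-comm (toℕ x) (toℕ y))

  isCommutativeRing : IsCommutativeRing _≡_ _+F_ _*F_ negF 0F 1F
  isCommutativeRing = record
    { isRing = record
      { +-isAbelianGroup = record
        { isGroup = record
          { isMonoid = record
            { isSemigroup = record
              { isMagma = record { isEquivalence = isEquivalence ; ∙-cong = cong₂ _+F_ }
              ; assoc = +F-assoc }
            ; identity = +F-identityˡ , λ x → trans (+F-comm x 0F) (+F-identityˡ x) }
          ; inverse = (λ x → trans (+F-comm (negF x) x) (+F-inverseʳ x)) , +F-inverseʳ
          ; ⁻¹-cong = cong negF }
        ; comm = +F-comm }
      ; *-cong = cong₂ _*F_
      ; *-assoc = *F-assoc
      ; *-identity = *F-identityˡ , λ x → trans (*F-comm x 1F) (*F-identityˡ x)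
      ; distrib = *F-distribˡ , λ x y z → trans (*F-comm (y +F z) x)
                                           (trans (*F-distribˡ x y z) (cong₂ _+F_ (*F-comm x y) (*F-comm x z))) }
    ; *-comm = *F-comm }

  -F≡+negF : ∀ x y → x -F y ≡ x +F negF y
  -F≡+negF x y = begin
    [ toℕ x + (p ∸ toℕ y) ]   ≡⟨ sym ([+] (toℕ x) (p ∸ toℕ y)) ⟩
    [ toℕ x ] +F negF y        ≡⟨ cong (_+F negF y) ([toℕ] x) ⟩
    x +F negF y                ∎

  toℕ-0F : toℕ 0F ≡ 0
  toℕ-0F = trans (toℕ-[] 0) (m<n⇒m%n≡m (ℕ.>-nonZero⁻¹ p))

  p∣toℕ⇒≡0F : ∀ x → p ∣ toℕ x → x ≡ 0F
  p∣toℕ⇒≡0F x p∣x with toℕ x in eq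
  ... | zero  = toℕ-injective (trans eq (sym toℕ-0F))
  ... | suc _ = ⊥-elim (ℕ.<⇒≱ (subst (_< p) eq (toℕ<n x)) (∣⇒≤ p∣x))

  zero-product : ∀ x y → x *F y ≡ 0F → x ≡ 0F ⊎ y ≡ 0F
  zero-product x y xy≡0 with euclidsLemma (toℕ x) (toℕ y) pr p∣xy
    where
    p∣xy : p ∣ toℕ x * toℕ y
    p∣xy = m%n≡0⇒n∣m _ p (trans (sym (toℕ-[] _)) (trans (cong toℕ xy≡0) toℕ-0F))
  ... | inj₁ p∣x = inj₁ (p∣toℕ⇒≡0F x p∣x)
  ... | inj₂ p∣y = inj₂ (p∣toℕ⇒≡0F y p∣y)

  inverse : ∀ x → x ≢ 0F → ∃ λ y → x *F y ≡ 1F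
  inverse x x≢0 = injective⇒surjective (x *F_) (*-cancelˡ x≢0) 1F
    where open IntegralDomain isCommutativeRing zero-product using (*-cancelˡ)

  1+1≢0 : 2 < p → 1F +F 1F ≢ 0F
  1+1≢0 2<p 1+1≡0 = 2≢0 (begin
    2                         ≡⟨ sym (m<n⇒m%n≡m 2<p) ⟩
    2 % p                     ≡⟨ sym (toℕ-[] 2) ⟩
    toℕ [ 1 + 1 ]             ≡⟨ cong toℕ (sym ([+] 1 1)) ⟩
    toℕ (1F +F 1F)            ≡⟨ cong toℕ 1+1≡0 ⟩
    toℕ 0F                    ≡⟨ toℕ-0F ⟩
    0                         ∎)
    where
    2≢0 : 2 ≢ 0
    2≢0 ()

  χ≡1⇒square : ∀ x → χ x ≡ 1ℤ → x ≢ 0F × ∃ λ y → y *F y ≡ x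
  χ≡1⇒square x χx≡1 with x ≟F 0F
  ... | yes _ with () ← χx≡1
  ... | no x≢0 with any? (λ y → (y *F y) ≟F x)
  ...   | yes square = x≢0 , square
  ...   | no _ with () ← χx≡1

  χ≡-1⇒nonsquare : ∀ x → χ x ≡ -1ℤ → ¬ ∃ λ y → y *F y ≡ x
  χ≡-1⇒nonsquare x χx≡-1 with x ≟F 0F
  ... | yes _ with () ← χx≡-1
  ... | no x≢0 with any? (λ y → (y *F y) ≟F x)
  ...   | yes _ with () ← χx≡-1
  ...   | no nonsquare = nonsquare

data Side : Set where
  left right : Side

opposite : Side → Side
opposite left  = right
opposite right = left

data Block : Set where
  hub leaf : Side → Block

hub-injective : ∀ {s s'} → hub s ≡ hub s' → s ≡ s'
hub-injective refl = refl

leaf≢hub : ∀ {s s'} → leaf s ≢ hub s'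
leaf≢hub ()

data BlockAdj : Block → Block → Set where
  hub-hub  : ∀ s → BlockAdj (hub s) (hub (opposite s))
  hub-leaf : ∀ s → BlockAdj (hub s) (leaf s)
  leaf-hub : ∀ s → BlockAdj (leaf s) (hub s)

BlockAdj-sym : ∀ {X Y} → BlockAdj X Y → BlockAdj Y X
BlockAdj-sym (hub-hub left)  = hub-hub right
BlockAdj-sym (hub-hub right) = hub-hub left
BlockAdj-sym (hub-leaf s)    = leaf-hub s
BlockAdj-sym (leaf-hub s)    = hub-leaf s

BlockAdj-irrefl : ∀ X → ¬ BlockAdj X X
BlockAdj-irrefl (hub left)  ()
BlockAdj-irrefl (hub right) ()
BlockAdj-irrefl (leaf s)    ()

mirror : Block → Block
mirror (hub s)  = hub (opposite s)
mirror (leaf s) = leaf (opposite s)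

mirror-involutive : ∀ X → mirror (mirror X) ≡ X
mirror-involutive (hub left)   = refl
mirror-involutive (hub right)  = refl
mirror-involutive (leaf left)  = refl
mirror-involutive (leaf right) = refl

mirror-BlockAdj : ∀ {X Y} → BlockAdj X Y → BlockAdj (mirror X) (mirror Y)
mirror-BlockAdj (hub-hub s)  = hub-hub (opposite s)
mirror-BlockAdj (hub-leaf s) = hub-leaf (opposite s)
mirror-BlockAdj (leaf-hub s) = leaf-hub (opposite s)

orient : Side → Block → Block
orient left  X = X
orient right X = mirror X

orient-BlockAdj⁻¹ : ∀ s {X Y} → BlockAdj (orient s X) (orient s Y) → BlockAdj X Y
orient-BlockAdj⁻¹ left  adj = adj
orient-BlockAdj⁻¹ right {X} {Y} adj =
  subst₂ BlockAdj (mirror-involutive X) (mirror-involutive Y) (mirror-BlockAdj adj)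

SameHub : Block → Block → Set
SameHub X Y = ∃ λ s → X ≡ hub s × Y ≡ hub s

sameHub? : ∀ X Y → Dec (SameHub X Y)
sameHub? (hub left)  (hub left)  = yes (left , refl , refl)
sameHub? (hub right) (hub right) = yes (right , refl , refl)
sameHub? (hub left)  (hub right) = no λ { (_ , refl , ()) }
sameHub? (hub right) (hub left)  = no λ { (_ , refl , ()) }
sameHub? (hub _)     (leaf _)    = no λ { (_ , _ , ()) }
sameHub? (leaf _)    _           = no λ { (_ , () , _) }

forcedHub : Block → Side
forcedHub (hub s)  = opposite s
forcedHub (leaf s) = s

common-neighbour-block : ∀ {X Y Z} → ¬ SameHub X Y → BlockAdj X Z → BlockAdj Y Z → Z ≡ hub (forcedHub X)
common-neighbour-block _      (hub-hub s)  _              = refl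
common-neighbour-block ¬same  (hub-leaf s) (hub-leaf .s)  = ⊥-elim (¬same (s , refl , refl))
common-neighbour-block _      (leaf-hub s) _              = refl

hub-neighbours : ∀ {s Z} → BlockAdj (hub s) Z → Z ≡ hub (opposite s) ⊎ Z ≡ leaf s
hub-neighbours (hub-hub s)  = inj₁ refl
hub-neighbours (hub-leaf s) = inj₂ refl

turn : Side → Side → Side
turn left  t = t
turn right t = opposite t

orient-hub : ∀ σ t → orient σ (hub t) ≡ hub (turn σ t)
orient-hub left  t = refl
orient-hub right t = refl

orient-leaf : ∀ σ t → orient σ (leaf t) ≡ leaf (turn σ t)
orient-leaf left  t = refl
orient-leaf right t = refl

turn-left : ∀ σ → turn σ left ≡ σ
turn-left left  = refl
turn-left right = refl

turn-right : ∀ σ → turn σ right ≡ opposite σ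
turn-right left  = refl
turn-right right = refl

turn-opposite : ∀ σ t → opposite (turn σ t) ≡ turn σ (opposite t)
turn-opposite left  t     = refl
turn-opposite right left  = refl
turn-opposite right right = refl

module Blocks (k : ℕ) (5≤k : 5 ≤ k) where

  -- Vertex i : Fin (2 * k) has label i + 1: the hubs are labels {1, 2} (left) and {3, 4} (right), the
  -- leaves {5, …, k + 2} (left) and {k + 3, …, 2k} (right); H_k joins each hub to the other hub pair and
  -- to the leaves on its own side.
  blockℕ : ℕ → Block
  blockℕ 0 = hub left
  blockℕ 1 = hub left
  blockℕ 2 = hub right
  blockℕ 3 = hub right
  blockℕ n@(suc (suc (suc (suc _)))) with n <? k + 2
  ... | yes _ = leaf left
  ... | no _  = leaf right

  InBlock : Block → ℕ → Set
  InBlock (hub left)   n = n < 2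
  InBlock (hub right)  n = 2 ≤ n × n < 4
  InBlock (leaf left)  n = 4 ≤ n × n < k + 2
  InBlock (leaf right) n = k + 2 ≤ n

  blockℕ-spec : ∀ n → InBlock (blockℕ n) n
  blockℕ-spec 0 = s≤s z≤n
  blockℕ-spec 1 = s≤s (s≤s z≤n)
  blockℕ-spec 2 = s≤s (s≤s z≤n) , s≤s (s≤s (s≤s z≤n))
  blockℕ-spec 3 = s≤s (s≤s z≤n) , s≤s (s≤s (s≤s (s≤s z≤n)))
  blockℕ-spec n@(suc (suc (suc (suc _)))) with n <? k + 2
  ... | yes n<k+2 = s≤s (s≤s (s≤s (s≤s z≤n))) , n<k+2
  ... | no n≮k+2  = ℕ.≮⇒≥ n≮k+2

  blockℕ-leaf-left : ∀ {n} → 4 ≤ n → n < k + 2 → blockℕ n ≡ leaf left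
  blockℕ-leaf-left {n} (s≤s (s≤s (s≤s (s≤s _)))) n<k+2 with n <? k + 2
  ... | yes _     = refl
  ... | no n≮k+2  = ⊥-elim (n≮k+2 n<k+2)

  4≤k+2 : 4 ≤ k + 2
  4≤k+2 = ℕ.≤-trans (ℕ.≤-trans (s≤s (s≤s (s≤s (s≤s z≤n)))) 5≤k) (ℕ.m≤m+n k 2)

  blockℕ-leaf-right : ∀ {n} → k + 2 ≤ n → blockℕ n ≡ leaf right
  blockℕ-leaf-right {n} k+2≤n with ℕ.≤-trans 4≤k+2 k+2≤n
  ... | s≤s (s≤s (s≤s (s≤s _))) with n <? k + 2
  ... | yes n<k+2 = ⊥-elim (ℕ.<⇒≱ n<k+2 k+2≤n)
  ... | no _      = refl

  block : Fin (2 * k) → Block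
  block i = blockℕ (toℕ i)

  one-or-two : ∀ {a} → a < 2 → suc a ≡ 1 ⊎ suc a ≡ 2
  one-or-two (s≤s z≤n)       = inj₁ refl
  one-or-two (s≤s (s≤s z≤n)) = inj₂ refl

  three-or-four : ∀ {a} → 2 ≤ a → a < 4 → suc a ≡ 3 ⊎ suc a ≡ 4
  three-or-four {2} _ _ = inj₁ refl
  three-or-four {3} _ _ = inj₂ refl
  three-or-four {suc (suc (suc (suc _)))} _ (s≤s (s≤s (s≤s (s≤s ()))))
  three-or-four {1} (s≤s ()) _

  hub-left-arc : ∀ {a b} → a < 2 → 2 ≤ b → b < k + 2 → HArc k (suc a) (suc b)
  hub-left-arc a<2 2≤b b<k+2 = inj₁ (one-or-two a<2 , s≤s 2≤b , b<k+2)

  hub-right-arc : ∀ {a b} → 2 ≤ a → a < 4 → k + 2 ≤ b → b < 2 * k → HArc k (suc a) (suc b)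
  hub-right-arc 2≤a a<4 k+2≤b b<2k = inj₂ (three-or-four 2≤a a<4 , s≤s k+2≤b , b<2k)

  HEdgeℕ : ℕ → ℕ → Set
  HEdgeℕ a b = HArc k (suc a) (suc b) ⊎ HArc k (suc b) (suc a)

  BlockAdj⇒HEdgeℕ : ∀ {X Y a b} → BlockAdj X Y → InBlock X a → InBlock Y b → a < 2 * k → b < 2 * k → HEdgeℕ a b
  BlockAdj⇒HEdgeℕ (hub-hub left)   a<2         (2≤b , b<4)  _ _ = inj₁ (hub-left-arc a<2 2≤b (ℕ.<-≤-trans b<4 4≤k+2))
  BlockAdj⇒HEdgeℕ (hub-hub right)  (2≤a , a<4) b<2          _ _ = inj₂ (hub-left-arc b<2 2≤a (ℕ.<-≤-trans a<4 4≤k+2))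
  BlockAdj⇒HEdgeℕ (hub-leaf left)  a<2         (4≤b , b<k+2) _ _ = inj₁ (hub-left-arc a<2 (ℕ.≤-trans (s≤s (s≤s z≤n)) 4≤b) b<k+2)
  BlockAdj⇒HEdgeℕ (hub-leaf right) (2≤a , a<4) k+2≤b        _ b<2k = inj₁ (hub-right-arc 2≤a a<4 k+2≤b b<2k)
  BlockAdj⇒HEdgeℕ (leaf-hub left)  (4≤a , a<k+2) b<2        _ _ = inj₂ (hub-left-arc b<2 (ℕ.≤-trans (s≤s (s≤s z≤n)) 4≤a) a<k+2)
  BlockAdj⇒HEdgeℕ (leaf-hub right) k+2≤a       (2≤b , b<4)  a<2k _ = inj₂ (hub-right-arc 2≤b b<4 k+2≤a a<2k)

  hub-left-neighbour : ∀ {b} → 2 ≤ b → b < k + 2 → BlockAdj (hub left) (blockℕ b)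
  hub-left-neighbour {2} _ _ = hub-hub left
  hub-left-neighbour {3} _ _ = hub-hub left
  hub-left-neighbour {1} (s≤s ()) _
  hub-left-neighbour {suc (suc (suc (suc _)))} _ b<k+2 =
    subst (BlockAdj (hub left)) (sym (blockℕ-leaf-left (s≤s (s≤s (s≤s (s≤s z≤n)))) b<k+2)) (hub-leaf left)

  hub-right-neighbour : ∀ {b} → k + 2 ≤ b → BlockAdj (hub right) (blockℕ b)
  hub-right-neighbour k+2≤b = subst (BlockAdj (hub right)) (sym (blockℕ-leaf-right k+2≤b)) (hub-leaf right)

  HArc⇒BlockAdj : ∀ a b → HArc k (suc a) (suc b) → BlockAdj (blockℕ a) (blockℕ b)
  HArc⇒BlockAdj _ _ (inj₁ (inj₁ refl , 3≤1+b , 1+b≤k+2)) = hub-left-neighbour (ℕ.≤-pred 3≤1+b) 1+b≤k+2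
  HArc⇒BlockAdj _ _ (inj₁ (inj₂ refl , 3≤1+b , 1+b≤k+2)) = hub-left-neighbour (ℕ.≤-pred 3≤1+b) 1+b≤k+2
  HArc⇒BlockAdj _ _ (inj₂ (inj₁ refl , k+2<1+b , _))     = hub-right-neighbour (ℕ.≤-pred k+2<1+b)
  HArc⇒BlockAdj _ _ (inj₂ (inj₂ refl , k+2<1+b , _))     = hub-right-neighbour (ℕ.≤-pred k+2<1+b)

  HEdge⇒BlockAdj : ∀ {i j} → HEdge k i j → BlockAdj (block i) (block j)
  HEdge⇒BlockAdj {i} {j} (inj₁ arc) = HArc⇒BlockAdj (toℕ i) (toℕ j) arc
  HEdge⇒BlockAdj {i} {j} (inj₂ arc) = BlockAdj-sym (HArc⇒BlockAdj (toℕ j) (toℕ i) arc)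

  BlockAdj⇒HEdge : ∀ {i j} → BlockAdj (block i) (block j) → HEdge k i j
  BlockAdj⇒HEdge {i} {j} adj = BlockAdj⇒HEdgeℕ adj (blockℕ-spec (toℕ i)) (blockℕ-spec (toℕ j)) (toℕ<n i) (toℕ<n j)

  vertex : (n : ℕ) → n < 2 * k → Fin (2 * k)
  vertex n n<2k = fromℕ< n<2k

  block-vertex : ∀ n (n<2k : n < 2 * k) → block (vertex n n<2k) ≡ blockℕ n
  block-vertex _ n<2k = cong blockℕ (toℕ-fromℕ< n<2k)

  vertex-toℕ : ∀ n (n<2k : n < 2 * k) {i} → toℕ i ≡ n → i ≡ vertex n n<2k
  vertex-toℕ _ n<2k toℕi≡n = toℕ-injective (trans toℕi≡n (sym (toℕ-fromℕ< n<2k)))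

  k+5≤2k : k + 5 ≤ 2 * k
  k+5≤2k = ℕ.+-monoʳ-≤ k (ℕ.≤-trans 5≤k (ℕ.≤-reflexive (sym (ℕ.+-identityʳ k))))

  small<2k : ∀ {n} → n ≤ 6 → n < 2 * k
  small<2k n≤6 = ℕ.≤-trans (s≤s n≤6) (ℕ.≤-trans (ℕ.+-monoˡ-≤ 2 5≤k) (ℕ.≤-trans (ℕ.+-monoʳ-≤ k (s≤s (s≤s z≤n))) k+5≤2k))

  k+2<2k : k + 2 < 2 * k
  k+2<2k = ℕ.<-≤-trans (ℕ.+-monoʳ-< k (s≤s (s≤s (s≤s z≤n)))) k+5≤2k

  in-block : ∀ {X} j → block j ≡ X → InBlock X (toℕ j)
  in-block j e = subst (λ X → InBlock X (toℕ j)) e (blockℕ-spec (toℕ j))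

  hubℕ₁ hubℕ₂ : Side → ℕ
  hubℕ₁ left  = 0
  hubℕ₁ right = 2
  hubℕ₂ left  = 1
  hubℕ₂ right = 3

  hubℕ₁≤6 : ∀ s → hubℕ₁ s ≤ 6
  hubℕ₁≤6 left  = z≤n
  hubℕ₁≤6 right = s≤s (s≤s z≤n)

  hubℕ₂≤6 : ∀ s → hubℕ₂ s ≤ 6
  hubℕ₂≤6 left  = s≤s z≤n
  hubℕ₂≤6 right = s≤s (s≤s (s≤s z≤n))

  hub₁ hub₂ : Side → Fin (2 * k)
  hub₁ s = vertex (hubℕ₁ s) (small<2k (hubℕ₁≤6 s))
  hub₂ s = vertex (hubℕ₂ s) (small<2k (hubℕ₂≤6 s))

  block-hub₁ : ∀ s → block (hub₁ s) ≡ hub s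
  block-hub₁ left  = block-vertex 0 (small<2k (hubℕ₁≤6 left))
  block-hub₁ right = block-vertex 2 (small<2k (hubℕ₁≤6 right))

  block-hub₂ : ∀ s → block (hub₂ s) ≡ hub s
  block-hub₂ left  = block-vertex 1 (small<2k (hubℕ₂≤6 left))
  block-hub₂ right = block-vertex 3 (small<2k (hubℕ₂≤6 right))

  hub₁≢hub₂ : ∀ s → hub₁ s ≢ hub₂ s
  hub₁≢hub₂ s eq = distinct s (trans (sym (toℕ-fromℕ< _)) (trans (cong toℕ eq) (toℕ-fromℕ< _)))
    where
    distinct : ∀ s → hubℕ₁ s ≢ hubℕ₂ s
    distinct left  ()
    distinct right ()

  hub-indices : ∀ {s n} → InBlock (hub s) n → n ≡ hubℕ₁ s ⊎ n ≡ hubℕ₂ s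
  hub-indices {left}  (s≤s z≤n)       = inj₁ refl
  hub-indices {left}  (s≤s (s≤s z≤n)) = inj₂ refl
  hub-indices {right} {2} _ = inj₁ refl
  hub-indices {right} {3} _ = inj₂ refl
  hub-indices {right} {1} (s≤s () , _)
  hub-indices {right} {suc (suc (suc (suc _)))} (_ , s≤s (s≤s (s≤s (s≤s ()))))

  hub-vertices : ∀ {s} i → block i ≡ hub s → i ≡ hub₁ s ⊎ i ≡ hub₂ s
  hub-vertices {s} i block-i≡hub with hub-indices (subst (λ X → InBlock X (toℕ i)) block-i≡hub (blockℕ-spec (toℕ i)))
  ... | inj₁ i≡hub₁ = inj₁ (vertex-toℕ (hubℕ₁ s) (small<2k (hubℕ₁≤6 s)) i≡hub₁)
  ... | inj₂ i≡hub₂ = inj₂ (vertex-toℕ (hubℕ₂ s) (small<2k (hubℕ₂≤6 s)) i≡hub₂)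

  hub-edges : ∀ {s i X} → BlockAdj (hub s) X → block i ≡ X → HEdge k (hub₁ s) i × HEdge k (hub₂ s) i
  hub-edges {s} adj refl =
    BlockAdj⇒HEdge (subst (λ X → BlockAdj X _) (sym (block-hub₁ s)) adj) ,
    BlockAdj⇒HEdge (subst (λ X → BlockAdj X _) (sym (block-hub₂ s)) adj)

  hub-cover : ∀ {s a b j} → block a ≡ hub s → block b ≡ hub s → a ≢ b → block j ≡ hub s → j ≡ a ⊎ j ≡ b
  hub-cover {s} {a} {b} {j} ea eb a≢b ej with hub-vertices a ea | hub-vertices b eb | hub-vertices j ej
  ... | inj₁ refl | inj₁ refl | _         = ⊥-elim (a≢b refl)
  ... | inj₂ refl | inj₂ refl | _         = ⊥-elim (a≢b refl)
  ... | inj₁ refl | inj₂ refl | inj₁ refl = inj₁ refl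
  ... | inj₁ refl | inj₂ refl | inj₂ refl = inj₂ refl
  ... | inj₂ refl | inj₁ refl | inj₁ refl = inj₂ refl
  ... | inj₂ refl | inj₁ refl | inj₂ refl = inj₁ refl

  spokeℕ : Side → Fin 5 → ℕ
  spokeℕ left  t                     = suc (suc (toℕ t))
  spokeℕ right zero                  = 0
  spokeℕ right (suc zero)            = 1
  spokeℕ right (suc (suc t))         = suc (suc (k + toℕ t))

  spokeℕ<2k : ∀ s t → spokeℕ s t < 2 * k
  spokeℕ<2k left  t             = small<2k (s≤s (s≤s (ℕ.≤-pred (toℕ<n t))))
  spokeℕ<2k right zero          = small<2k z≤n
  spokeℕ<2k right (suc zero)    = small<2k (s≤s z≤n)
  spokeℕ<2k right (suc (suc t)) = ℕ.≤-trans (ℕ.≤-reflexive shift) (ℕ.≤-trans (ℕ.+-monoʳ-≤ k (s≤s (s≤s (toℕ<n t)))) k+5≤2k)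
    where
    shift : suc (suc (suc (k + toℕ t))) ≡ k + suc (suc (suc (toℕ t)))
    shift = sym (trans (ℕ.+-suc k _) (cong suc (trans (ℕ.+-suc k _) (cong suc (ℕ.+-suc k (toℕ t))))))

  spokeℕ-injective : ∀ s {t t'} → spokeℕ s t ≡ spokeℕ s t' → t ≡ t'
  spokeℕ-injective left                              eq = toℕ-injective (ℕ.suc-injective (ℕ.suc-injective eq))
  spokeℕ-injective right {zero}        {zero}        _  = refl
  spokeℕ-injective right {suc zero}    {suc zero}    _  = refl
  spokeℕ-injective right {suc (suc t)} {suc (suc t')} eq =
    cong suc (cong suc (toℕ-injective (ℕ.+-cancelˡ-≡ k _ _ (ℕ.suc-injective (ℕ.suc-injective eq)))))
  spokeℕ-injective right {zero}        {suc zero}    ()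
  spokeℕ-injective right {zero}        {suc (suc _)} ()
  spokeℕ-injective right {suc zero}    {zero}        ()
  spokeℕ-injective right {suc zero}    {suc (suc _)} ()
  spokeℕ-injective right {suc (suc _)} {zero}        ()
  spokeℕ-injective right {suc (suc _)} {suc zero}    ()

  hub-spokeℕ : ∀ s t → BlockAdj (hub s) (blockℕ (spokeℕ s t))
  hub-spokeℕ left  t             = hub-left-neighbour (s≤s (s≤s z≤n))
                                     (ℕ.<-≤-trans (s≤s (s≤s (ℕ.<-≤-trans (toℕ<n t) 5≤k))) (ℕ.≤-reflexive (ℕ.+-comm 2 k)))
  hub-spokeℕ right zero          = hub-hub right
  hub-spokeℕ right (suc zero)    = hub-hub right
  hub-spokeℕ right (suc (suc t)) = hub-right-neighbour (ℕ.≤-trans (ℕ.≤-reflexive (ℕ.+-comm k 2)) (s≤s (s≤s (ℕ.m≤m+n k (toℕ t)))))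

  spoke : Side → Fin 5 → Fin (2 * k)
  spoke s t = vertex (spokeℕ s t) (spokeℕ<2k s t)

  spoke-injective : ∀ s {t t'} → spoke s t ≡ spoke s t' → t ≡ t'
  spoke-injective s eq = spokeℕ-injective s (trans (sym (toℕ-fromℕ< _)) (trans (cong toℕ eq) (toℕ-fromℕ< _)))

  hub-spoke-edges : ∀ s t → HEdge k (hub₁ s) (spoke s t) × HEdge k (hub₂ s) (spoke s t)
  hub-spoke-edges s t = hub-edges (hub-spokeℕ s t) (block-vertex (spokeℕ s t) (spokeℕ<2k s t))

module Copies (k : ℕ) (5≤k : 5 ≤ k) (p : ℕ) (pr : Prime p) (2<p : 2 < p) (lam : ℕ → Fin p)
  (lam-injective : ∀ i j → 1 ≤ i → i ≤ 2 ℕ.* k → 1 ≤ j → j ≤ 2 ℕ.* k → i ≢ j → lam i ≢ lam j) where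

  open Fp p pr using (F; 0F; _-F_; _*F_; χ)
  open Gp p k pr lam using (GArc; GAdj; IsCopy; EdgeOf)
  open PrimeField p pr using (isCommutativeRing; zero-product; inverse; 1+1≢0; -F≡+negF; χ≡1⇒square; χ≡-1⇒nonsquare)
  open MomentCurve isCommutativeRing _≟F_ zero-product inverse (1+1≢0 2<p) public
  open Blocks k 5≤k

  L : Fin (2 ℕ.* k) → F
  L i = lam (lab i)

  L-injective : ∀ {i j} → i ≢ j → L i ≢ L j
  L-injective {i} {j} i≢j = lam-injective (lab i) (lab j) (s≤s z≤n) (toℕ<n i) (s≤s z≤n) (toℕ<n j)
                              (λ e → i≢j (toℕ-injective (ℕ.suc-injective e)))

  HEdge-irrefl : ∀ {i j} → HEdge k i j → i ≢ j
  HEdge-irrefl e refl = BlockAdj-irrefl _ (HEdge⇒BlockAdj e)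

  open ParabolaGraph _≟F_ (HEdge k) HEdge-irrefl L L-injective public

  GArc⇒step : ∀ {x i y j} → GArc (x , i) (y , j) → HArc k (lab i) (lab j) × ∃ λ a → a ≢ 0F × y ≡ move (L j - L i) a x
  GArc⇒step {x₁ , x₂} {i} {y} {j} (arc , a , a≢0 , e) =
    arc , a , a≢0 , trans e (cong (λ s → move s a (x₁ , x₂)) (-F≡+negF (L j) (L i)))

  GAdj⇒Adj : ∀ {u v} → GAdj u v → Adj u v
  GAdj⇒Adj (inj₁ arc) with GArc⇒step arc
  ... | h , a , _ , e = inj₁ h , a , e
  GAdj⇒Adj (inj₂ arc) with GArc⇒step arc
  ... | h , a , _ , e = inj₂ h , step-sym (a , e)

  line-copy : ∀ o {c} → c ≢ 0F → IsCopy (lineV o c)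
  line-copy o@(o₁ , o₂) {c} c≢0 = (λ a b e → cong proj₂ e) , edge
    where
    arc : ∀ a b → HArc k (lab a) (lab b) → GArc (lineV o c a) (lineV o c b)
    arc a b h = h , c , c≢0 , trans (line-step o c (L a) (L b)) (cong (λ s → move s c (line o c (L a))) (sym (-F≡+negF (L b) (L a))))
    edge : ∀ a b → HEdge k a b → GAdj (lineV o c a) (lineV o c b)
    edge a b (inj₁ h) = inj₁ (arc a b h)
    edge a b (inj₂ h) = inj₂ (arc b a h)

  edge-on-line : ∀ {u v} → GAdj u v → ∃₂ λ o c → c ≢ 0F × EdgeOf (lineV o c) u v
  edge-on-line {x , i} {y , j} (inj₁ garc) with GArc⇒step garc
  ... | h , a , a≢0 , e = move (- L i) a x , a , a≢0 , i , j , inj₁ h ,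
                          cong (_, i) (sym (proj₁ (step-on-line {κ = L i} e))) , cong (_, j) (sym (proj₂ (step-on-line {κ = L i} e)))
  edge-on-line {x , i} {y , j} (inj₂ garc) with GArc⇒step garc
  ... | h , a , a≢0 , e = move (- L j) a y , a , a≢0 , i , j , inj₂ h ,
                          cong (_, i) (sym (proj₂ (step-on-line {κ = L j} e))) , cong (_, j) (sym (proj₁ (step-on-line {κ = L j} e)))

  edge-in-a-copy : ∀ {u v} → GAdj u v → Σ (Fin (2 ℕ.* k) → Vertex) (λ φ → IsCopy φ × EdgeOf φ u v)
  edge-in-a-copy uv with edge-on-line uv
  ... | o , c , c≢0 , uv-on-line = lineV o c , line-copy o c≢0 , uv-on-line

  hubCross : Side → Fin (2 ℕ.* k) → F
  hubCross s j = cross (L (hub₁ s)) (L (hub₂ s)) (L j)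

  crossV-hub : ∀ {P Q} u → block (proj₂ P) ≡ hub u → block (proj₂ Q) ≡ hub u → proj₂ P ≢ proj₂ Q →
    ∀ j → crossV P Q j ≡ hubCross u j
  crossV-hub {_ , α} {_ , β} u eα eβ α≢β j with hub-vertices α eα | hub-vertices β eβ
  ... | inj₁ refl | inj₁ refl = ⊥-elim (α≢β refl)
  ... | inj₂ refl | inj₂ refl = ⊥-elim (α≢β refl)
  ... | inj₁ refl | inj₂ refl = refl
  ... | inj₂ refl | inj₁ refl = cross-sym _ _ _

  L-vertex : ∀ n n<2k → L (vertex n n<2k) ≡ lam (suc n)
  L-vertex n n<2k = cong (λ m → lam (suc m)) (toℕ-fromℕ< n<2k)

  hubCross≡ : ∀ s j → hubCross s j ≡ (L j -F lam (suc (hubℕ₁ s))) *F (lam (suc (hubℕ₂ s)) -F L j)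
  hubCross≡ s j = cong₂ _*F_
    (trans (cong (λ x → L j - x) (L-vertex (hubℕ₁ s) (small<2k (hubℕ₁≤6 s)))) (sym (-F≡+negF (L j) (lam (suc (hubℕ₁ s))))))
    (trans (cong (λ x → x - L j) (L-vertex (hubℕ₂ s) (small<2k (hubℕ₂≤6 s)))) (sym (-F≡+negF (lam (suc (hubℕ₂ s))) (L j))))

  hub-nonsquare : (∀ i → (i ≡ 3 ⊎ i ≡ 4) → χ ((lam i -F lam 1) *F (lam 2 -F lam i)) ≡ -1ℤ) →
                  (∀ j → (j ≡ 1 ⊎ j ≡ 2) → χ ((lam j -F lam 3) *F (lam 4 -F lam j)) ≡ -1ℤ) →
                  ∀ s j → block j ≡ hub (opposite s) → ¬ IsSquare (hubCross s j)
  hub-nonsquare χ-hub-left _ left j e = subst (λ h → ¬ IsSquare h) (sym (hubCross≡ left j))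
    (χ≡-1⇒nonsquare _ (χ-hub-left (lab j) (three-or-four (proj₁ (in-block j e)) (proj₂ (in-block j e)))))
  hub-nonsquare _ χ-hub-right right j e = subst (λ h → ¬ IsSquare h) (sym (hubCross≡ right j))
    (χ≡-1⇒nonsquare _ (χ-hub-right (lab j) (one-or-two (in-block j e))))

  leaf-square : (∀ i j → 5 ≤ i → i ≤ k ℕ.+ 2 → k ℕ.+ 2 < j → j ≤ 2 ℕ.* k →
                   (χ ((lam i -F lam 1) *F (lam 2 -F lam i)) ≡ 1ℤ) × (χ ((lam j -F lam 3) *F (lam 4 -F lam j)) ≡ 1ℤ)) →
                ∀ s j → block j ≡ leaf s → NonzeroSquare (hubCross s j)
  leaf-square χ-leaves left  j e = subst NonzeroSquare (sym (hubCross≡ left j))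
    (χ≡1⇒square _ (proj₁ (χ-leaves (lab j) (2 ℕ.* k) (s≤s (proj₁ (in-block j e))) (proj₂ (in-block j e)) k+2<2k ℕ.≤-refl)))
  leaf-square χ-leaves right j e = subst NonzeroSquare (sym (hubCross≡ right j))
    (χ≡1⇒square _ (proj₂ (χ-leaves 5 (lab j) ℕ.≤-refl (ℕ.≤-trans 5≤k (ℕ.m≤m+n k 2)) (s≤s (in-block j e)) (toℕ<n j))))

  module CopyStructure
    (hub-cross-nonsquare : ∀ s j → block j ≡ hub (opposite s) → ¬ IsSquare (hubCross s j))
    (leaf-cross-square : ∀ s j → block j ≡ leaf s → NonzeroSquare (hubCross s j))
    {φ : Fin (2 ℕ.* k) → Vertex} (copy : IsCopy φ) where

    π : Fin (2 ℕ.* k) → Fin (2 ℕ.* k)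
    π i = proj₂ (φ i)

    φ-≢ : ∀ {a b} → a ≢ b → φ a ≢ φ b
    φ-≢ a≢b e = a≢b (proj₁ copy _ _ e)

    φ-adj : ∀ {a b} → HEdge k a b → Adj (φ a) (φ b)
    φ-adj {a} {b} e = GAdj⇒Adj (proj₂ copy a b e)

    block-π-adj : ∀ {a b} → HEdge k a b → BlockAdj (block (π a)) (block (π b))
    block-π-adj e = HEdge⇒BlockAdj (proj₁ (φ-adj e))

    φ-common : ∀ {a b j} → HEdge k a j × HEdge k b j → Common (φ a) (φ b) (φ j)
    φ-common (ea , eb) = φ-adj ea , φ-adj eb

    hub-hub-common : ∀ s {j} → block j ≡ hub (opposite s) → Common (φ (hub₁ s)) (φ (hub₂ s)) (φ j)
    hub-hub-common s e = φ-common (hub-edges (hub-hub s) e)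

    -- Otherwise the five spokes of s, common neighbours of its two hubs, would map into the two parts of a
    -- single hub block.
    hub-images-same-hub : ∀ s → SameHub (block (π (hub₁ s))) (block (π (hub₂ s)))
    hub-images-same-hub s with sameHub? (block (π (hub₁ s))) (block (π (hub₂ s)))
    ... | yes same = same
    ... | no ¬same = ⊥-elim (no-five-common-neighbours (λ t → φ (spoke s t)) (φ-≢ (hub₁≢hub₂ s))
                               (λ e → spoke-injective s (proj₁ copy _ _ e)) (λ t → φ-common (hub-spoke-edges s t)) two-parts)
      where
      f : Side
      f = forcedHub (block (π (hub₁ s)))
      two-parts : ∀ t → π (spoke s t) ≡ hub₁ f ⊎ π (spoke s t) ≡ hub₂ f
      two-parts t = hub-vertices _ (common-neighbour-block ¬same (block-π-adj (proj₁ (hub-spoke-edges s t)))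
                                                                 (block-π-adj (proj₂ (hub-spoke-edges s t))))

    σ : Side
    σ = proj₁ (hub-images-same-hub left)

    right-side : proj₁ (hub-images-same-hub right) ≡ opposite σ
    right-side = hub-side (hub-neighbours (subst₂ BlockAdj
                   (proj₁ (proj₂ (hub-images-same-hub left))) (proj₁ (proj₂ (hub-images-same-hub right)))
                   (block-π-adj (proj₁ (hub-edges (hub-hub left) (block-hub₁ right))))))
      where
      hub-side : ∀ {s} → hub s ≡ hub (opposite σ) ⊎ hub s ≡ leaf σ → s ≡ opposite σ
      hub-side (inj₁ e) = hub-injective e

    block-π-hub : ∀ t → block (π (hub₁ t)) ≡ hub (turn σ t) × block (π (hub₂ t)) ≡ hub (turn σ t)
    block-π-hub left  = subst (λ s → block (π (hub₁ left)) ≡ hub s × block (π (hub₂ left)) ≡ hub s) (sym (turn-left σ))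
                          (proj₂ (hub-images-same-hub left))
    block-π-hub right = subst (λ s → block (π (hub₁ right)) ≡ hub s × block (π (hub₂ right)) ≡ hub s) (trans right-side (sym (turn-right σ)))
                          (proj₂ (hub-images-same-hub right))

    pair-on-line : ∀ t → π (hub₁ t) ≢ π (hub₂ t) → ∃₂ λ o c → OnLine o c (φ (hub₁ t)) × OnLine o c (φ (hub₂ t))
    pair-on-line t apart =
      collinear (λ t' → φ (spoke t t')) apart (hub-hub-common t (block-hub₁ (opposite t))) opposite-nonsquare classify
                (λ e → spoke-injective t (proj₁ copy _ _ e)) (λ t' → φ-common (hub-spoke-edges t t'))
      where
      u : Side
      u = turn σ t
      cross≡ : ∀ j → crossV (φ (hub₁ t)) (φ (hub₂ t)) j ≡ hubCross u j
      cross≡ = crossV-hub {φ (hub₁ t)} {φ (hub₂ t)} u (proj₁ (block-π-hub t)) (proj₂ (block-π-hub t)) apart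
      opposite-nonsquare : ¬ IsSquare (crossV (φ (hub₁ t)) (φ (hub₂ t)) (π (hub₁ (opposite t))))
      opposite-nonsquare = subst (λ h → ¬ IsSquare h) (sym (cross≡ _))
        (hub-cross-nonsquare u _ (trans (proj₁ (block-π-hub (opposite t))) (cong hub (sym (turn-opposite σ t)))))
      classify : ∀ {v} → Common (φ (hub₁ t)) (φ (hub₂ t)) v →
        (proj₂ v ≡ hub₁ (opposite u) ⊎ proj₂ v ≡ hub₂ (opposite u)) ⊎ NonzeroSquare (crossV (φ (hub₁ t)) (φ (hub₂ t)) (proj₂ v))
      classify {_ , j} ((e , _) , _) with hub-neighbours (subst (λ X → BlockAdj X (block j)) (proj₁ (block-π-hub t)) (HEdge⇒BlockAdj e))
      ... | inj₁ in-opposite-hub = inj₁ (hub-vertices j in-opposite-hub)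
      ... | inj₂ in-leaf         = inj₂ (subst NonzeroSquare (sym (cross≡ j)) (leaf-cross-square u j in-leaf))

    -- If the left hubs shared a part, their two common neighbours among the right hubs could not, so the
    -- right hubs would span a line; being their common neighbours, the left hubs would lie on it in one part.
    left-hubs-apart : π (hub₁ left) ≢ π (hub₂ left)
    left-hubs-apart same = φ-≢ (hub₁≢hub₂ left) (same-part-on-line (on-right-line (block-hub₁ left)) (on-right-line (block-hub₂ left)) same)
      where
      right-hubs-apart : π (hub₁ right) ≢ π (hub₂ right)
      right-hubs-apart same' = φ-≢ (hub₁≢hub₂ right) (common-neighbours-same-part (φ-≢ (hub₁≢hub₂ left)) same same'
                                 (hub-hub-common left (block-hub₁ right)) (hub-hub-common left (block-hub₂ right)))
      right-line = pair-on-line right right-hubs-apart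
      on-right-line : ∀ {j} → block j ≡ hub left → OnLine (proj₁ right-line) (proj₁ (proj₂ right-line)) (φ j)
      on-right-line e = common-neighbour-on-line (proj₁ (proj₂ (proj₂ right-line))) (proj₂ (proj₂ (proj₂ right-line)))
                          right-hubs-apart (hub-hub-common right e)

    o : Point
    o = proj₁ (pair-on-line left left-hubs-apart)

    c : F
    c = proj₁ (proj₂ (pair-on-line left left-hubs-apart))

    hub-on-line : ∀ t → OnLine o c (φ (hub₁ t)) × OnLine o c (φ (hub₂ t))
    hub-on-line left  = proj₂ (proj₂ (pair-on-line left left-hubs-apart))
    hub-on-line right = on-line (block-hub₁ right) , on-line (block-hub₂ right)
      where
      on-line : ∀ {j} → block j ≡ hub right → OnLine o c (φ j)
      on-line e = common-neighbour-on-line (proj₁ (hub-on-line left)) (proj₂ (hub-on-line left)) left-hubs-apart (hub-hub-common left e)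

    hubs-apart : ∀ t → π (hub₁ t) ≢ π (hub₂ t)
    hubs-apart t same = φ-≢ (hub₁≢hub₂ t) (same-part-on-line {o} {c} {φ (hub₁ t)} {φ (hub₂ t)} (proj₁ (hub-on-line t)) (proj₂ (hub-on-line t)) same)

    on-line-in : ∀ i X → block i ≡ X → OnLine o c (φ i)
    on-line-in i (leaf t) eq = common-neighbour-on-line {o} {c} {φ (hub₁ t)} {φ (hub₂ t)} {φ i}
                                 (proj₁ (hub-on-line t)) (proj₂ (hub-on-line t)) (hubs-apart t) (φ-common (hub-edges (hub-leaf t) eq))
    on-line-in i (hub t) eq = [ (λ e → subst (λ j → OnLine o c (φ j)) (sym e) (proj₁ (hub-on-line t))) ,
                                (λ e → subst (λ j → OnLine o c (φ j)) (sym e) (proj₂ (hub-on-line t))) ] (hub-vertices i eq)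

    on-line : ∀ i → OnLine o c (φ i)
    on-line i = on-line-in i (block i) refl

    π-injective : ∀ {a b} → π a ≡ π b → a ≡ b
    π-injective {a} {b} e = proj₁ copy a b (same-part-on-line {o} {c} {φ a} {φ b} (on-line a) (on-line b) e)

    block-π-in : ∀ i X → block i ≡ X → block (π i) ≡ orient σ X
    block-π-in i (hub t) eq = trans ([ (λ e → trans (cong (block ∘ π) e) (proj₁ (block-π-hub t))) ,
                                       (λ e → trans (cong (block ∘ π) e) (proj₂ (block-π-hub t))) ] (hub-vertices i eq))
                                    (sym (orient-hub σ t))
    block-π-in i (leaf t) eq = image-block (hub-neighbours (subst (λ X → BlockAdj X (block (π i))) (proj₁ (block-π-hub t))
                                                          (block-π-adj {hub₁ t} {i} (proj₁ (hub-edges {i = i} (hub-leaf t) eq)))))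
      where
      apart-from-hub : ∀ {j} → block j ≡ hub (opposite t) → π i ≢ π j
      apart-from-hub {j} in-hub π-i≡π-j = leaf≢hub (trans (sym eq) (trans (cong block (π-injective {i} {j} π-i≡π-j)) in-hub))
      not-a-hub : ¬ (π i ≡ π (hub₁ (opposite t)) ⊎ π i ≡ π (hub₂ (opposite t)))
      not-a-hub (inj₁ e) = apart-from-hub {hub₁ (opposite t)} (block-hub₁ (opposite t)) e
      not-a-hub (inj₂ e) = apart-from-hub {hub₂ (opposite t)} (block-hub₂ (opposite t)) e
      image-block : block (π i) ≡ hub (opposite (turn σ t)) ⊎ block (π i) ≡ leaf (turn σ t) → block (π i) ≡ orient σ (leaf t)
      image-block (inj₁ in-hub)  = ⊥-elim (not-a-hub (hub-cover {turn σ (opposite t)} {π (hub₁ (opposite t))} {π (hub₂ (opposite t))} {π i}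
                                                      (proj₁ (block-π-hub (opposite t))) (proj₂ (block-π-hub (opposite t)))
                                                      (hubs-apart (opposite t)) (trans in-hub (cong hub (turn-opposite σ t)))))
      image-block (inj₂ in-leaf) = trans in-leaf (sym (orient-leaf σ t))

    block-π : ∀ i → block (π i) ≡ orient σ (block i)
    block-π i = block-π-in i (block i) refl

    π-reflects : ∀ {a b} → HEdge k (π a) (π b) → HEdge k a b
    π-reflects {a} {b} e = BlockAdj⇒HEdge {a} {b} (orient-BlockAdj⁻¹ σ (subst₂ BlockAdj (block-π a) (block-π b) (HEdge⇒BlockAdj {π a} {π b} e)))

    edges : ∀ w z → EdgeOf φ w z ⇔ EdgeOf (lineV o c) w z
    edges w z = mk⇔ to from
      where
      φ≡lineV : ∀ i → φ i ≡ lineV o c (π i)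
      φ≡lineV i = OnLine⇒lineV {o} {c} {φ i} (on-line i)
      to : EdgeOf φ w z → EdgeOf (lineV o c) w z
      to (a , b , e , ea , eb) = π a , π b , proj₁ (φ-adj {a} {b} e) , trans (sym (φ≡lineV a)) ea , trans (sym (φ≡lineV b)) eb
      from-preimages : ∀ {a' b'} → (∃ λ a → π a ≡ a') → (∃ λ b → π b ≡ b') →
        HEdge k a' b' → lineV o c a' ≡ w → lineV o c b' ≡ z → EdgeOf φ w z
      from-preimages (a , refl) (b , refl) e' ea eb = a , b , π-reflects {a} {b} e' , trans (φ≡lineV a) ea , trans (φ≡lineV b) eb
      from : EdgeOf (lineV o c) w z → EdgeOf φ w z
      from (a' , b' , e' , ea , eb) =
        from-preimages (injective⇒surjective π π-injective a') (injective⇒surjective π π-injective b') e' ea eb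

  module _
    (hub-cross-nonsquare : ∀ s j → block j ≡ hub (opposite s) → ¬ IsSquare (hubCross s j))
    (leaf-cross-square : ∀ s j → block j ≡ leaf s → NonzeroSquare (hubCross s j)) where

    private module ⇔ = IsEquivalence (⇔-isEquivalence {ℓ = 0ℓ})

    copies-sharing-an-edge-agree : ∀ {u v} φ ψ → IsCopy φ → EdgeOf φ u v → IsCopy ψ → EdgeOf ψ u v →
      ∀ w z → EdgeOf φ w z ⇔ EdgeOf ψ w z
    copies-sharing-an-edge-agree {u} {v} φ ψ copy-φ uv∈φ copy-ψ uv∈ψ w z =
      ⇔.trans (subst₂ (λ o c → EdgeOf φ w z ⇔ EdgeOf (lineV o c) w z) (proj₁ same-line) (proj₂ same-line) (Φ.edges w z))
              (⇔.sym (Ψ.edges w z))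
      where
      module Φ = CopyStructure hub-cross-nonsquare leaf-cross-square copy-φ
      module Ψ = CopyStructure hub-cross-nonsquare leaf-cross-square copy-ψ
      lines-sharing-an-edge : ∀ {o c o' c'} → EdgeOf (lineV o c) u v → EdgeOf (lineV o' c') u v → o ≡ o' × c ≡ c'
      lines-sharing-an-edge {o} {c} {o'} {c'} (a , b , e , ea , eb) (a' , b' , _ , ea' , eb') =
        shared-edge⇒same-line {o} {c} {o'} {c'} {a} {b} {a'} {b'} e (trans ea (sym ea')) (trans eb (sym eb'))
      same-line : Φ.o ≡ Ψ.o × Φ.c ≡ Ψ.c
      same-line = lines-sharing-an-edge {Φ.o} {Φ.c} {Ψ.o} {Ψ.c} (Equivalence.to (Φ.edges u v) uv∈φ) (Equivalence.to (Ψ.edges u v) uv∈ψ)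

p%4≡1⇒2<p : ∀ p → Prime p → p % 4 ≡ 1 → 2 < p
p%4≡1⇒2<p 1 pr _ = ⊥-elim (¬prime[1] pr)
p%4≡1⇒2<p (suc (suc (suc (suc _)))) _ _ = s≤s (s≤s (s≤s z≤n))

proposition2 :
    (k : ℕ) → 5 ≤ k →
    (p : ℕ) → (pr : Prime p) → p % 4 ≡ 1 →
    (lam : ℕ → Fin p) →
    let open Fp p pr
        open Gp p k pr lam
    in
    (∀ i j → 1 ≤ i → i ≤ 2 * k → 1 ≤ j → j ≤ 2 * k → i ≢ j → lam i ≢ lam j) →
    lam 1 ≡ 0F → lam 2 ≡ 1F →
    (∀ i → (i ≡ 3 ⊎ i ≡ 4) → χ ((lam i -F lam 1) *F (lam 2 -F lam i)) ≡ -1ℤ) →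
    (∀ j → (j ≡ 1 ⊎ j ≡ 2) → χ ((lam j -F lam 3) *F (lam 4 -F lam j)) ≡ -1ℤ) →
    (∀ i j → 5 ≤ i → i ≤ k + 2 → k + 2 < j → j ≤ 2 * k →
       (χ ((lam i -F lam 1) *F (lam 2 -F lam i)) ≡ 1ℤ) ×
       (χ ((lam j -F lam 3) *F (lam 4 -F lam j)) ≡ 1ℤ)) →
    (u v : V) → GAdj u v →
      Σ (Fin (2 * k) → V) (λ φ → IsCopy φ × EdgeOf φ u v) ×
      ((φ ψ : Fin (2 * k) → V) → IsCopy φ → EdgeOf φ u v → IsCopy ψ → EdgeOf ψ u v →
        (w z : V) → EdgeOf φ w z ⇔ EdgeOf ψ w z)
proposition2 k 5≤k p pr p%4≡1 lam lam-injective _ _ χ-hub-left χ-hub-right χ-leaves u v uv =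
  edge-in-a-copy uv ,
  copies-sharing-an-edge-agree (hub-nonsquare χ-hub-left χ-hub-right) (leaf-square χ-leaves)
  where open Copies k 5≤k p pr (p%4≡1⇒2<p p pr p%4≡1) lam lam-injective
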